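{- (Rescaling Theorem) Let $q$ be a power of an odd prime, $\varepsilon=\left(\frac{ -1}{q}\right)$, $m=(q-\varepsilon)/4$. Let $j',\ell'\in\mathbb{F}_q$ with $j'+\ell'\ne0$ and $\varepsilon_1,\varepsilon_2\in\{1,-1\}$. Put $\lambda=(j'+\ell')/4$, $\nu=\left(\frac{j'+\ell'}{q}\right)$, $j=j'/\lambda$, $\ell=\ell'/\lambda$ (so $j+\ell=4$). Then $$\prod\mathcal{T}_{j',\ell'}^{\varepsilon_1,\varepsilon_2}=\prod\mathcal{S}_{ -j',\ell'}^{\varepsilon\varepsilon_1,\varepsilon_2}=\lambda^{m-\beta-\gamma}\prod\mathcal{S}_{ -j,\ell}^{\nu\varepsilon\varepsilon_1,\nu\varepsilon_2}=\lambda^{m-\beta-\gamma}\prod\mathcal{T}_{j,\ell}^{\nu\varepsilon_1,\nu\varepsilon_2},$$ where $\beta=1$ if $\left(\frac{j'}{q}\right)=\varepsilon_1$ and $\left(\frac{\ell'}{q}\right)=\varepsilon_2$, and $\beta=0$ otherwise; and $\gamma=1$ if ($\nu=\varepsilon\varepsilon_1=\varepsilon_2$) or ($-\varepsilon=\nu\varepsilon_1=1$), and $\gamma=0$ otherwise.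
   Context: $\mathbb{F}_q$ is the field with $q$ elements. For $a\in\mathbb{F}_q$, $\left(\frac{a}{q}\right)$ is the Legendre symbol ($1$ on nonzero squares, $-1$ on nonsquares, $0$ at $0$); $\varepsilon=\left(\frac{ -1}{q}\right)=(-1)^{(q-1)/2}$. For finite $S\subset\mathbb{F}_q^\times$, $\prod S$ is the product of its elements ($\prod\emptyset=1$). For $k\ne\ell$, $\mathcal{S}_{k,\ell}^{\varepsilon_1,\varepsilon_2}=\{a\in\mathbb{F}_q^\times:\left(\frac{a+k}{q}\right)=\varepsilon_1,\left(\frac{a+\ell}{q}\right)=\varepsilon_2\}$; for $j+\ell\ne0$, $\mathcal{T}_{j,\ell}^{\varepsilon_1,\varepsilon_2}=\{a\in\mathbb{F}_q^\times:\left(\frac{j-a}{q}\right)=\varepsilon_1,\left(\frac{\ell+a}{q}\right)=\varepsilon_2\}$. -}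

module Defs where

open import Data.Nat as ℕ using (ℕ; zero; suc)
open import Data.Integer as ℤ using (ℤ; +_; -[1+_]; 0ℤ; 1ℤ; -1ℤ)
open import Data.Integer.DivMod using (_/_)
open import Data.List using (List; foldr; filter; length)
open import Data.List.Membership.Propositional using (_∈_)
open import Data.List.Relation.Unary.Unique.Propositional using (Unique)
open import Data.List.Relation.Unary.Any using (Any; any?)
open import Data.Product using (_×_; _,_)
open import Relation.Binary.PropositionalEquality using (_≡_; _≢_)
open import Relation.Binary.Definitions using (DecidableEquality)
open import Relation.Nullary using (Dec; yes; no; ¬_)
open import Relation.Nullary.Decidable using (_×-dec_; _⊎-dec_; ¬?)
open import Algebra.Structures using (IsCommutativeRing)

record FiniteField : Set₁ where
  infixl 7 _*_
  infixl 6 _+_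
  field
    Carrier : Set
    _+_ _*_ : Carrier → Carrier → Carrier
    -_ : Carrier → Carrier
    0# 1# : Carrier
    isCommutativeRing : IsCommutativeRing _≡_ _+_ _*_ -_ 0# 1#
    1≢0 : 1# ≢ 0#
    _⁻¹ : Carrier → Carrier
    *-inverse : ∀ x → x ≢ 0# → x * (x ⁻¹) ≡ 1#
    _≟_ : DecidableEquality Carrier
    elems : List Carrier
    elems-complete : ∀ x → x ∈ elems
    elems-unique : Unique elems

module _ (F : FiniteField) where
  open FiniteField F

  order : ℕ
  order = length elems

  legendre : Carrier → ℤ
  legendre a with a ≟ 0#
  ... | yes _ = 0ℤ
  ... | no _ with any? (λ b → (b * b) ≟ a) elems
  ...   | yes _ = 1ℤ
  ...   | no _ = -1ℤ

  epsilon : ℤ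
  epsilon = legendre (- 1#)

  mm : ℤ
  mm = (+ order ℤ.- epsilon) / (+ 4)

  prodL : List Carrier → Carrier
  prodL = foldr _*_ 1#

  _/F_ : Carrier → Carrier → Carrier
  x /F y = x * (y ⁻¹)

  pow : Carrier → ℕ → Carrier
  pow x zero = 1#
  pow x (suc n) = x * pow x n

  zpow : Carrier → ℤ → Carrier
  zpow x (+ n) = pow x n
  zpow x -[1+ n ] = pow (x ⁻¹) (suc n)

  four : Carrier
  four = 1# + 1# + 1# + 1#

  SSet : Carrier → Carrier → ℤ → ℤ → List Carrier
  SSet k l e1 e2 = filter (λ a → ¬? (a ≟ 0#) ×-dec (legendre (a + k) ℤ.≟ e1) ×-dec (legendre (a + l) ℤ.≟ e2)) elems

  TSet : Carrier → Carrier → ℤ → ℤ → List Carrier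
  TSet j l e1 e2 = filter (λ a → ¬? (a ≟ 0#) ×-dec (legendre (j + (- a)) ℤ.≟ e1) ×-dec (legendre (l + a) ℤ.≟ e2)) elems

  prodS : Carrier → Carrier → ℤ → ℤ → Carrier
  prodS k l e1 e2 = prodL (SSet k l e1 e2)

  prodT : Carrier → Carrier → ℤ → ℤ → Carrier
  prodT j l e1 e2 = prodL (TSet j l e1 e2)

  betaC : Carrier → Carrier → ℤ → ℤ → ℤ
  betaC j' l' e1 e2 with (legendre j' ℤ.≟ e1) ×-dec (legendre l' ℤ.≟ e2)
  ... | yes _ = 1ℤ
  ... | no _ = 0ℤ

  gammaC : ℤ → ℤ → ℤ → ℤ
  gammaC ν e1 e2 with ((ν ℤ.≟ epsilon ℤ.* e1) ×-dec (epsilon ℤ.* e1 ℤ.≟ e2))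
                      ⊎-dec ((ℤ.- epsilon ℤ.≟ ν ℤ.* e1) ×-dec (ν ℤ.* e1 ℤ.≟ 1ℤ))
  ... | yes _ = 1ℤ
  ... | no _ = 0ℤ

-- The outer equalities are the substitution ((j - a)/q) = ε ((a - j)/q).  For the middle one,
-- a ↦ λ a maps S_{-j,ℓ}^{νεε₁,νε₂} onto S_{-j',ℓ'}^{εε₁,ε₂} because (λ/q) = ν, so the two products differ
-- by λ^|S|, and it remains to show |S| = m - β - γ, which is pure counting.  For k ≠ ℓ let
-- N(u,v) = #{a ∈ F_q : ((a+k)/q) = u, ((a+ℓ)/q) = v}.  Each row N(u,v) + N(u,-v) and each column
-- N(u,v) + N(-u,v) of this 2×2 table is (q-1)/2 up to the one a at which a factor vanishes; the
-- anti-diagonal counts the a with ((a+k)(a+ℓ)/q) = -uv, and writing (a+k)(a+ℓ) = t (t+D) = t² (1 + D/t)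
-- turns it into the symbol count of a bijection of F_q, again (q-1)/2 up to one term.  Hence 2 N(u,v)
-- is determined.  For (k,ℓ) = (0,1) this gives m = N(1,1) + 1; for (k,ℓ) = (-j',ℓ'), removing a = 0
-- accounts for β and the boundary terms combine into γ.  Since F_q is only given as an enumerated
-- field, #squares = (q-1)/2 and the multiplicativity of the Legendre symbol are proved by counting too.

module Submission where

open import Defs
open import Algebra.Bundles using (CommutativeMonoid; CommutativeRing; CommutativeSemigroup)
open import Algebra.Structures using (IsCommutativeMonoid)
import Algebra.Properties.CommutativeSemigroup as CommutativeSemigroupProperties
import Algebra.Solver.CommutativeMonoid as CommutativeMonoidSolver
open import Data.Bool using (Bool; true; false; if_then_else_; not; _∧_)
open import Data.Bool.Properties using (∧-identityʳ; ∧-zeroʳ; ∧-comm)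
open import Data.Empty using (⊥-elim)
open import Data.Fin using (#_)
open import Data.Integer as ℤ using (ℤ; 0ℤ; 1ℤ; -1ℤ)
import Data.Integer.Properties as ℤ
open import Data.Integer.DivMod using (div-pos-is-/ℕ)
open import Data.Integer.Solver using () renaming (module +-*-Solver to ℤ-Solver)
open import Data.List using (List; []; _∷_; length; filter)
open import Data.List.Membership.Propositional using (_∈_; find; lose)
open import Data.List.Membership.Propositional.Properties using (∈-filter⁺; ∈-filter⁻)
open import Data.List.Relation.Unary.All using () renaming (lookup to All-lookup)
open import Data.List.Relation.Unary.AllPairs using (_∷_)
open import Data.List.Relation.Unary.Any using (here; there; any?)
open import Data.List.Relation.Unary.Unique.Propositional using (Unique)
open import Data.List.Relation.Unary.Unique.Propositional.Properties using (filter⁺)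
open import Data.Nat as ℕ using (ℕ; zero; suc; _%_)
import Data.Nat.Properties as ℕ
open import Data.Nat.DivMod using (m*n%n≡0; m*n/n≡m)
open import Data.Nat.Solver using (module +-*-Solver)
open import Data.Product using (_×_; _,_; proj₂)
open import Data.Sum using (_⊎_; inj₁; inj₂)
open import Data.Vec using ([]; _∷_)
open import Function.Base using (_∘_)
open import Function.Bundles using (mk⇔)
open import Relation.Binary.Definitions using (DecidableEquality)
open import Relation.Binary.PropositionalEquality using (_≡_; _≢_; refl; sym; trans; cong; cong₂; module ≡-Reasoning)
open import Relation.Nullary using (Dec; yes; no; does)
open import Relation.Nullary.Decidable using (dec-true; dec-false; does-⇔; ¬?; _×-dec_; _⊎-dec_)
open import Relation.Unary using (Decidable)

open ≡-Reasoning

open CommutativeSemigroupProperties ℕ.+-commutativeSemigroup using () renaming (interchange to +-interchange)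

-- Counting along lists

iverson : Bool → ℕ
iverson b = if b then 1 else 0

count : {A : Set} → (A → Bool) → List A → ℕ
count p [] = 0
count p (x ∷ xs) = iverson (p x) ℕ.+ count p xs

module _ {A : Set} where

  count-cong : {p q : A → Bool} → (∀ x → p x ≡ q x) → ∀ xs → count p xs ≡ count q xs
  count-cong eq [] = refl
  count-cong eq (x ∷ xs) = cong₂ ℕ._+_ (cong iverson (eq x)) (count-cong eq xs)

  count-≡0 : (p : A → Bool) (xs : List A) → (∀ x → x ∈ xs → p x ≡ false) → count p xs ≡ 0
  count-≡0 p [] _ = refl
  count-≡0 p (x ∷ xs) all-false rewrite all-false x (here refl) =
    count-≡0 p xs (λ y y∈xs → all-false y (there y∈xs))

  count-≡0⇒false : (p : A → Bool) (xs : List A) → count p xs ≡ 0 → ∀ x → x ∈ xs → p x ≡ false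
  count-≡0⇒false p (y ∷ xs) count≡0 x x∈ with p y in py
  count-≡0⇒false p (y ∷ xs) () x x∈ | true
  count-≡0⇒false p (y ∷ xs) count≡0 x (here refl) | false = py
  count-≡0⇒false p (y ∷ xs) count≡0 x (there x∈) | false = count-≡0⇒false p xs count≡0 x x∈

  count-≟ : (_≟_ : DecidableEquality A) (t : A) (ys : List A) → Unique ys → t ∈ ys →
            count (λ s → does (t ≟ s)) ys ≡ 1
  count-≟ _≟_ t (y ∷ ys) (t∉ys ∷ _) (here refl) with t ≟ t
  ... | yes _ = cong suc (count-≡0 _ ys λ s s∈ys → dec-false (t ≟ s) (All-lookup t∉ys s∈ys))
  ... | no t≢t = ⊥-elim (t≢t refl)
  count-≟ _≟_ t (y ∷ ys) (y∉ys ∷ unique) (there t∈ys) with t ≟ y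
  ... | yes refl = ⊥-elim (All-lookup y∉ys t∈ys refl)
  ... | no _ = count-≟ _≟_ t ys unique t∈ys

  count-∧-≟ : (_≟_ : DecidableEquality A) (t : A) (ys : List A) → Unique ys → t ∈ ys → (c : A → Bool) →
              count (λ s → c s ∧ does (t ≟ s)) ys ≡ iverson (c t)
  count-∧-≟ _≟_ t ys unique t∈ys c =
    trans (count-cong only-at-t ys) (at-t (c t))
    where
    only-at-t : ∀ s → c s ∧ does (t ≟ s) ≡ c t ∧ does (t ≟ s)
    only-at-t s with t ≟ s
    ... | yes refl = refl
    ... | no _ = trans (∧-zeroʳ (c s)) (sym (∧-zeroʳ (c t)))
    at-t : ∀ b → count (λ s → b ∧ does (t ≟ s)) ys ≡ iverson b
    at-t true = count-≟ _≟_ t ys unique t∈ys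
    at-t false = count-≡0 _ ys (λ _ _ → refl)

  count-+ : (p q r : A → Bool) → (∀ x → iverson (p x) ℕ.+ iverson (q x) ≡ iverson (r x)) →
            ∀ xs → count p xs ℕ.+ count q xs ≡ count r xs
  count-+ p q r pointwise [] = refl
  count-+ p q r pointwise (x ∷ xs) =
    trans (+-interchange (iverson (p x)) (count p xs) (iverson (q x)) (count q xs))
          (cong₂ ℕ._+_ (pointwise x) (count-+ p q r pointwise xs))

  count-+₃ : (p q r s : A → Bool) →
             (∀ x → iverson (p x) ℕ.+ iverson (q x) ℕ.+ iverson (r x) ≡ iverson (s x)) →
             ∀ xs → count p xs ℕ.+ count q xs ℕ.+ count r xs ≡ count s xs
  count-+₃ p q r s pointwise [] = refl
  count-+₃ p q r s pointwise (x ∷ xs) = begin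
    (a ℕ.+ as) ℕ.+ (b ℕ.+ bs) ℕ.+ (c ℕ.+ cs) ≡⟨ cong (ℕ._+ (c ℕ.+ cs)) (+-interchange a as b bs) ⟩
    (a ℕ.+ b) ℕ.+ (as ℕ.+ bs) ℕ.+ (c ℕ.+ cs) ≡⟨ +-interchange (a ℕ.+ b) (as ℕ.+ bs) c cs ⟩
    (a ℕ.+ b ℕ.+ c) ℕ.+ (as ℕ.+ bs ℕ.+ cs)   ≡⟨ cong₂ ℕ._+_ (pointwise x) (count-+₃ p q r s pointwise xs) ⟩
    iverson (s x) ℕ.+ count s xs ∎
    where
    a b c as bs cs : ℕ
    a = iverson (p x); b = iverson (q x); c = iverson (r x)
    as = count p xs; bs = count q xs; cs = count r xs

  length≡count+count-not : (p : A → Bool) (xs : List A) → length xs ≡ count p xs ℕ.+ count (not ∘ p) xs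
  length≡count+count-not p xs = sym (trans (count-+ p (not ∘ p) (λ _ → true) pointwise xs) (count-true xs))
    where
    pointwise : ∀ x → iverson (p x) ℕ.+ iverson (not (p x)) ≡ 1
    pointwise x with p x
    ... | true = refl
    ... | false = refl
    count-true : ∀ ys → count (λ _ → true) ys ≡ length ys
    count-true [] = refl
    count-true (_ ∷ ys) = cong suc (count-true ys)

  length-filter : {P : A → Set} (P? : Decidable P) (xs : List A) →
                  length (filter P? xs) ≡ count (λ x → does (P? x)) xs
  length-filter P? [] = refl
  length-filter P? (x ∷ xs) with does (P? x)
  ... | true = cong suc (length-filter P? xs)
  ... | false = length-filter P? xs

module BigOperator {M : Set} {_∙_ : M → M → M} {ε : M} (isCM : IsCommutativeMonoid _≡_ _∙_ ε) where
  open IsCommutativeMonoid isCM using (identityˡ; identityʳ; isCommutativeSemigroup)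

  commutativeSemigroup : CommutativeSemigroup _ _
  commutativeSemigroup = record { isCommutativeSemigroup = isCommutativeSemigroup }

  open CommutativeSemigroupProperties commutativeSemigroup using (interchange)

  bigop : {A : Set} → List A → (A → M) → M
  bigop [] w = ε
  bigop (x ∷ xs) w = w x ∙ bigop xs w

  _^_ : M → ℕ → M
  a ^ zero = ε
  a ^ suc n = a ∙ (a ^ n)

  module _ {A : Set} where

    bigop-cong : (xs : List A) {v w : A → M} → (∀ x → v x ≡ w x) → bigop xs v ≡ bigop xs w
    bigop-cong [] eq = refl
    bigop-cong (x ∷ xs) eq = cong₂ _∙_ (eq x) (bigop-cong xs eq)

    bigop-ε : (xs : List A) → bigop xs (λ _ → ε) ≡ ε
    bigop-ε [] = refl
    bigop-ε (x ∷ xs) = trans (identityˡ _) (bigop-ε xs)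

    bigop-∙ : (xs : List A) (v w : A → M) → bigop xs (λ x → v x ∙ w x) ≡ bigop xs v ∙ bigop xs w
    bigop-∙ [] v w = sym (identityˡ ε)
    bigop-∙ (x ∷ xs) v w = trans (cong ((v x ∙ w x) ∙_) (bigop-∙ xs v w)) (interchange _ _ _ _)

    bigop-if : (xs : List A) (p : A → Bool) (c : M) → bigop xs (λ x → if p x then c else ε) ≡ c ^ count p xs
    bigop-if [] p c = refl
    bigop-if (x ∷ xs) p c with p x
    ... | true = cong (c ∙_) (bigop-if xs p c)
    ... | false = trans (identityˡ _) (bigop-if xs p c)

  module _ {A : Set} (_≟_ : DecidableEquality A) where

    bigop-≟ : (t : A) (ys : List A) (c : A → M) → Unique ys → t ∈ ys →
              bigop ys (λ s → if does (t ≟ s) then c s else ε) ≡ c t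
    bigop-≟ t ys c unique t∈ys = begin
      bigop ys (λ s → if does (t ≟ s) then c s else ε) ≡⟨ bigop-cong ys only-at-t ⟩
      bigop ys (λ s → if does (t ≟ s) then c t else ε) ≡⟨ bigop-if ys _ (c t) ⟩
      c t ^ count (λ s → does (t ≟ s)) ys              ≡⟨ cong (c t ^_) (count-≟ _≟_ t ys unique t∈ys) ⟩
      c t ∙ ε                                          ≡⟨ identityʳ (c t) ⟩
      c t ∎
      where
      only-at-t : ∀ s → (if does (t ≟ s) then c s else ε) ≡ (if does (t ≟ s) then c t else ε)
      only-at-t s with t ≟ s
      ... | yes refl = refl
      ... | no _ = refl

    module _ (elems : List A) (unique : Unique elems) (complete : ∀ x → x ∈ elems) where

      bigop-fibres : (xs : List A) (f : A → A) (w : A → M) →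
                     bigop xs (w ∘ f) ≡ bigop elems (λ s → w s ^ count (λ x → does (f x ≟ s)) xs)
      bigop-fibres [] f w = sym (bigop-ε elems)
      bigop-fibres (x ∷ xs) f w = sym (begin
        bigop elems (λ s → w s ^ (iverson (does (f x ≟ s)) ℕ.+ count (λ y → does (f y ≟ s)) xs))
          ≡⟨ bigop-cong elems (λ s → ^-split (w s) (does (f x ≟ s)) _) ⟩
        bigop elems (λ s → (if does (f x ≟ s) then w s else ε) ∙ (w s ^ count (λ y → does (f y ≟ s)) xs))
          ≡⟨ bigop-∙ elems _ _ ⟩
        bigop elems (λ s → if does (f x ≟ s) then w s else ε) ∙ bigop elems (λ s → w s ^ count (λ y → does (f y ≟ s)) xs)
          ≡⟨ cong₂ _∙_ (bigop-≟ (f x) elems w unique (complete (f x))) (sym (bigop-fibres xs f w)) ⟩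
        w (f x) ∙ bigop xs (w ∘ f) ∎)
        where
        ^-split : ∀ a b n → a ^ (iverson b ℕ.+ n) ≡ (if b then a else ε) ∙ (a ^ n)
        ^-split a true n = refl
        ^-split a false n = sym (identityˡ _)

      bigop-reindex : (f g : A → A) → (∀ x → f (g x) ≡ x) → (∀ x → g (f x) ≡ x) → (w : A → M) →
                      bigop elems (w ∘ f) ≡ bigop elems w
      bigop-reindex f g fg gf w = trans (bigop-fibres elems f w) (bigop-cong elems singleton-fibre)
        where
        singleton-fibre : ∀ s → w s ^ count (λ x → does (f x ≟ s)) elems ≡ w s
        singleton-fibre s = begin
          w s ^ count (λ x → does (f x ≟ s)) elems ≡⟨ cong (w s ^_) (count-cong fibre≡ elems) ⟩
          w s ^ count (λ x → does (g s ≟ x)) elems ≡⟨ cong (w s ^_) (count-≟ _≟_ (g s) elems unique (complete (g s))) ⟩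
          w s ∙ ε                                 ≡⟨ identityʳ (w s) ⟩
          w s ∎
          where
          fibre≡ : ∀ x → does (f x ≟ s) ≡ does (g s ≟ x)
          fibre≡ x = does-⇔ (mk⇔ (λ fx≡s → trans (sym (cong g fx≡s)) (gf x))
                                 (λ gs≡x → trans (cong f (sym gs≡x)) (fg s)))
                            (f x ≟ s) (g s ≟ x)

module _ {A : Set} where
  open BigOperator ℕ.+-0-isCommutativeMonoid

  count-as-sum : (p : A → Bool) (xs : List A) → count p xs ≡ bigop xs (iverson ∘ p)
  count-as-sum p [] = refl
  count-as-sum p (x ∷ xs) = cong (iverson (p x) ℕ.+_) (count-as-sum p xs)

  1^n≡n : ∀ n → 1 ^ n ≡ n
  1^n≡n zero = refl
  1^n≡n (suc n) = cong suc (1^n≡n n)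

  module _ (_≟_ : DecidableEquality A) (elems : List A) (unique : Unique elems) (complete : ∀ x → x ∈ elems) where

    count-reindex : (f g : A → A) → (∀ x → f (g x) ≡ x) → (∀ x → g (f x) ≡ x) → (p : A → Bool) →
                    count (p ∘ f) elems ≡ count p elems
    count-reindex f g fg gf p = begin
      count (p ∘ f) elems           ≡⟨ count-as-sum (p ∘ f) elems ⟩
      bigop elems (iverson ∘ p ∘ f) ≡⟨ bigop-reindex _≟_ elems unique complete f g fg gf (iverson ∘ p) ⟩
      bigop elems (iverson ∘ p)     ≡⟨ count-as-sum p elems ⟨
      count p elems ∎

    module _ (xs : List A) (unique-xs : Unique xs) (f σ : A → A)
             (σ∈xs : ∀ x → x ∈ xs → σ x ∈ xs) (σx≢x : ∀ x → x ∈ xs → σ x ≢ x)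
             (fibre : ∀ x y → f x ≡ f y → y ≡ x ⊎ y ≡ σ x) (fσ≡f : ∀ x → f (σ x) ≡ f x) where

      count-fibre≡2 : ∀ {x₀} → x₀ ∈ xs → count (λ x → does (f x ≟ f x₀)) xs ≡ 2
      count-fibre≡2 {x₀} x₀∈xs = begin
        count (λ x → does (f x ≟ f x₀)) xs
          ≡⟨ count-+ (λ x → does (x₀ ≟ x)) (λ x → does (σ x₀ ≟ x)) _ pair xs ⟨
        count (λ x → does (x₀ ≟ x)) xs ℕ.+ count (λ x → does (σ x₀ ≟ x)) xs
          ≡⟨ cong₂ ℕ._+_ (count-≟ _≟_ x₀ xs unique-xs x₀∈xs)
                         (count-≟ _≟_ (σ x₀) xs unique-xs (σ∈xs x₀ x₀∈xs)) ⟩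
        2 ∎
        where
        pair : ∀ x → iverson (does (x₀ ≟ x)) ℕ.+ iverson (does (σ x₀ ≟ x)) ≡ iverson (does (f x ≟ f x₀))
        pair x with x₀ ≟ x | σ x₀ ≟ x
        ... | yes refl | yes σx₀≡x₀ = ⊥-elim (σx≢x x₀ x₀∈xs σx₀≡x₀)
        ... | yes refl | no _ = sym (cong iverson (dec-true (f x ≟ f x) refl))
        ... | no _ | yes refl = sym (cong iverson (dec-true (f (σ x₀) ≟ f x₀) (fσ≡f x₀)))
        ... | no x₀≢x | no σx₀≢x = sym (cong iverson (dec-false (f x ≟ f x₀) not-in-fibre))
          where
          not-in-fibre : f x ≢ f x₀
          not-in-fibre fx≡fx₀ with fibre x₀ x (sym fx≡fx₀)
          ... | inj₁ x≡x₀ = x₀≢x (sym x≡x₀)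
          ... | inj₂ x≡σx₀ = σx₀≢x (sym x≡σx₀)

      #image : ℕ
      #image = count (λ s → does (any? (λ x → f x ≟ s) xs)) elems

      length-two-to-one : length xs ≡ #image ℕ.+ #image
      length-two-to-one = begin
        length xs                                                ≡⟨ length-as-sum xs ⟩
        bigop xs (λ _ → 1)                                       ≡⟨ bigop-fibres _≟_ elems unique complete xs f (λ _ → 1) ⟩
        bigop elems (λ s → 1 ^ count (λ x → does (f x ≟ s)) xs) ≡⟨ bigop-cong elems fibre-size ⟩
        bigop elems (λ s → iverson (hit s) ℕ.+ iverson (hit s)) ≡⟨ bigop-∙ elems _ _ ⟩
        bigop elems (iverson ∘ hit) ℕ.+ bigop elems (iverson ∘ hit)
          ≡⟨ cong₂ ℕ._+_ (count-as-sum hit elems) (count-as-sum hit elems) ⟨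
        count hit elems ℕ.+ count hit elems ∎
        where
        hit : A → Bool
        hit s = does (any? (λ x → f x ≟ s) xs)
        length-as-sum : ∀ ys → length ys ≡ bigop ys (λ _ → 1)
        length-as-sum [] = refl
        length-as-sum (_ ∷ ys) = cong suc (length-as-sum ys)
        fibre-size : ∀ s → 1 ^ count (λ x → does (f x ≟ s)) xs ≡ iverson (hit s) ℕ.+ iverson (hit s)
        fibre-size s with any? (λ x → f x ≟ s) xs
        ... | yes s-hit with find s-hit
        ...   | x₀ , x₀∈xs , refl = trans (1^n≡n _) (count-fibre≡2 x₀∈xs)
        fibre-size s | no s-missed =
          trans (1^n≡n _) (count-≡0 _ xs (λ x x∈xs → dec-false (f x ≟ s) (λ fx≡s → s-missed (lose x∈xs fx≡s))))

-- Signs and finite sign identities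

data Sign : ℤ → Set where
  plus  : Sign 1ℤ
  minus : Sign -1ℤ

data Symbol : ℤ → Set where
  zero  : Symbol 0ℤ
  plus  : Symbol 1ℤ
  minus : Symbol -1ℤ

Sign-* : ∀ {u v} → Sign u → Sign v → Sign (u ℤ.* v)
Sign-* plus plus = plus
Sign-* plus minus = minus
Sign-* minus plus = minus
Sign-* minus minus = plus

Sign-neg : ∀ {u} → Sign u → Sign (ℤ.- u)
Sign-neg plus = minus
Sign-neg minus = plus

sign*[sign*x]≡x : ∀ {u} → Sign u → ∀ x → u ℤ.* (u ℤ.* x) ≡ x
sign*[sign*x]≡x plus x = trans (ℤ.*-identityˡ _) (ℤ.*-identityˡ x)
sign*[sign*x]≡x minus x = trans (ℤ.-1*i≡-i _) (trans (cong ℤ.-_ (ℤ.-1*i≡-i x)) (ℤ.neg-involutive x))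

does-≟-*sign : ∀ {u} → Sign u → ∀ x y → does (x ℤ.≟ y) ≡ does (u ℤ.* x ℤ.≟ u ℤ.* y)
does-≟-*sign {u} sign-u x y = does-⇔ (mk⇔ (cong (u ℤ.*_)) cancel) (x ℤ.≟ y) (u ℤ.* x ℤ.≟ u ℤ.* y)
  where
  cancel : u ℤ.* x ≡ u ℤ.* y → x ≡ y
  cancel ux≡uy = trans (sym (sign*[sign*x]≡x sign-u x)) (trans (cong (u ℤ.*_) ux≡uy) (sign*[sign*x]≡x sign-u y))

does-*sign-≟ : ∀ {u} → Sign u → ∀ x y → does (u ℤ.* x ℤ.≟ y) ≡ does (x ℤ.≟ u ℤ.* y)
does-*sign-≟ {u} sign-u x y = trans (does-≟-*sign sign-u (u ℤ.* x) y)
                               (cong (λ z → does (z ℤ.≟ u ℤ.* y)) (sign*[sign*x]≡x sign-u x))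

product-split : ∀ {x y u v} → Symbol x → Symbol y → Sign u → Sign v →
                iverson (does (x ℤ.≟ u) ∧ does (y ℤ.≟ ℤ.- v)) ℕ.+ iverson (does (x ℤ.≟ ℤ.- u) ∧ does (y ℤ.≟ v))
                  ≡ iverson (does (x ℤ.* y ℤ.≟ ℤ.- (u ℤ.* v)))
product-split zero zero plus plus = refl
product-split zero zero plus minus = refl
product-split zero zero minus plus = refl
product-split zero zero minus minus = refl
product-split zero plus plus plus = refl
product-split zero plus plus minus = refl
product-split zero plus minus plus = refl
product-split zero plus minus minus = refl
product-split zero minus plus plus = refl
product-split zero minus plus minus = refl
product-split zero minus minus plus = refl
product-split zero minus minus minus = refl
product-split plus zero plus plus = refl
product-split plus zero plus minus = refl
product-split plus zero minus plus = refl
product-split plus zero minus minus = refl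
product-split plus plus plus plus = refl
product-split plus plus plus minus = refl
product-split plus plus minus plus = refl
product-split plus plus minus minus = refl
product-split plus minus plus plus = refl
product-split plus minus plus minus = refl
product-split plus minus minus plus = refl
product-split plus minus minus minus = refl
product-split minus zero plus plus = refl
product-split minus zero plus minus = refl
product-split minus zero minus plus = refl
product-split minus zero minus minus = refl
product-split minus plus plus plus = refl
product-split minus plus plus minus = refl
product-split minus plus minus plus = refl
product-split minus plus minus minus = refl
product-split minus minus plus plus = refl
product-split minus minus plus minus = refl
product-split minus minus minus plus = refl
product-split minus minus minus minus = refl

γ-condition : ℤ → ℤ → ℤ → ℤ → Bool
γ-condition E ν e₁ e₂ =
  does (((ν ℤ.≟ E ℤ.* e₁) ×-dec (E ℤ.* e₁ ℤ.≟ e₂)) ⊎-dec ((ℤ.- E ℤ.≟ ν ℤ.* e₁) ×-dec (ν ℤ.* e₁ ℤ.≟ 1ℤ)))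

γ-table : ∀ {E V A B} → Sign E → Sign V → Sign A → Sign B →
          let γ = γ-condition E V A B
          in iverson (does (E ℤ.≟ 1ℤ)) ℕ.+ iverson (does (1ℤ ℤ.≟ ℤ.- (E ℤ.* A ℤ.* B))) ℕ.+ iverson γ ℕ.+ iverson γ
               ≡ 1 ℕ.+ iverson (does (E ℤ.* V ℤ.≟ E ℤ.* A)) ℕ.+ iverson (does (V ℤ.≟ B))
γ-table plus plus plus plus = refl
γ-table plus plus plus minus = refl
γ-table plus plus minus plus = refl
γ-table plus plus minus minus = refl
γ-table plus minus plus plus = refl
γ-table plus minus plus minus = refl
γ-table plus minus minus plus = refl
γ-table plus minus minus minus = refl
γ-table minus plus plus plus = refl
γ-table minus plus plus minus = refl
γ-table minus plus minus plus = refl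
γ-table minus plus minus minus = refl
γ-table minus minus plus plus = refl
γ-table minus minus plus minus = refl
γ-table minus minus minus plus = refl
γ-table minus minus minus minus = refl

[c+b+g]-b-g≡c : ∀ c b g → ℤ.+ (c ℕ.+ b ℕ.+ g) ℤ.- ℤ.+ b ℤ.- ℤ.+ g ≡ ℤ.+ c
[c+b+g]-b-g≡c c b g = begin
  ℤ.+ (c ℕ.+ b ℕ.+ g) ℤ.- ℤ.+ b ℤ.- ℤ.+ g
    ≡⟨ cong (λ z → z ℤ.- ℤ.+ b ℤ.- ℤ.+ g) (trans (ℤ.pos-+ (c ℕ.+ b) g) (cong (ℤ._+ ℤ.+ g) (ℤ.pos-+ c b))) ⟩
  (ℤ.+ c ℤ.+ ℤ.+ b ℤ.+ ℤ.+ g) ℤ.- ℤ.+ b ℤ.- ℤ.+ g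
    ≡⟨ solve 3 (λ c b g → c :+ b :+ g :- b :- g := c) refl (ℤ.+ c) (ℤ.+ b) (ℤ.+ g) ⟩
  ℤ.+ c ∎
  where open ℤ-Solver using (solve; _:+_; _:-_; _:=_)

-- Arithmetic of the counts

[n+n]%2≡0 : ∀ n → (n ℕ.+ n) % 2 ≡ 0
[n+n]%2≡0 n = trans (cong (λ m → (n ℕ.+ m) % 2) (sym (ℕ.+-identityʳ n))) (trans (cong (_% 2) (ℕ.*-comm 2 n)) (m*n%n≡0 n 2))

double-count : ∀ {n a b i j r h} → n ℕ.+ a ℕ.+ i ≡ h → n ℕ.+ b ℕ.+ j ≡ h → a ℕ.+ b ℕ.+ r ≡ h →
               n ℕ.+ n ℕ.+ i ℕ.+ j ≡ h ℕ.+ r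
double-count {n} {a} {b} {i} {j} {r} {h} row column antidiagonal = ℕ.+-cancelʳ-≡ (a ℕ.+ b) _ _ (begin
  n ℕ.+ n ℕ.+ i ℕ.+ j ℕ.+ (a ℕ.+ b)
    ≡⟨ solve 5 (λ n a b i j → n :+ n :+ i :+ j :+ (a :+ b) := (n :+ a :+ i) :+ (n :+ b :+ j)) refl n a b i j ⟩
  (n ℕ.+ a ℕ.+ i) ℕ.+ (n ℕ.+ b ℕ.+ j) ≡⟨ cong₂ ℕ._+_ row (trans column (sym antidiagonal)) ⟩
  h ℕ.+ (a ℕ.+ b ℕ.+ r)               ≡⟨ solve 4 (λ a b r h → h :+ (a :+ b :+ r) := h :+ r :+ (a :+ b)) refl a b r h ⟩
  h ℕ.+ r ℕ.+ (a ℕ.+ b) ∎)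
  where open +-*-Solver using (solve; _:+_; _:=_)

[1+2h-E]/4 : ∀ {E} → Sign E → ∀ {h n} → n ℕ.+ n ℕ.+ iverson (does (E ℤ.≟ 1ℤ)) ℕ.+ 1 ≡ h →
             (ℤ.+ suc (h ℕ.+ h) ℤ.- E) ℤ./ ℤ.+ 4 ≡ ℤ.+ (n ℕ.+ 1)
[1+2h-E]/4 {E} sign-E {h} {n} h≡ = begin
  (ℤ.+ suc (h ℕ.+ h) ℤ.- E) ℤ./ ℤ.+ 4 ≡⟨ cong (ℤ._/ ℤ.+ 4) (numerator sign-E h≡) ⟩
  ℤ.+ ((n ℕ.+ 1) ℕ.* 4) ℤ./ ℤ.+ 4     ≡⟨ div-pos-is-/ℕ (ℤ.+ ((n ℕ.+ 1) ℕ.* 4)) 4 ⟩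
  ℤ.+ ((n ℕ.+ 1) ℕ.* 4 ℕ./ 4)         ≡⟨ cong ℤ.+_ (m*n/n≡m (n ℕ.+ 1) 4) ⟩
  ℤ.+ (n ℕ.+ 1) ∎
  where
  open +-*-Solver using (solve; _:+_; _:*_; _:=_; con)
  numerator : ∀ {E} → Sign E → n ℕ.+ n ℕ.+ iverson (does (E ℤ.≟ 1ℤ)) ℕ.+ 1 ≡ h →
              ℤ.+ suc (h ℕ.+ h) ℤ.- E ≡ ℤ.+ ((n ℕ.+ 1) ℕ.* 4)
  numerator plus refl = cong ℤ.+_
    (solve 1 (λ n → (n :+ n :+ con 1 :+ con 1) :+ (n :+ n :+ con 1 :+ con 1) := (n :+ con 1) :* con 4) refl n)
  numerator minus refl = cong ℤ.+_
    (solve 1 (λ n → con 1 :+ ((n :+ n :+ con 0 :+ con 1) :+ (n :+ n :+ con 0 :+ con 1)) :+ con 1 := (n :+ con 1) :* con 4) refl n)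

exponent-count : ∀ {n n₀ c b g i j e r h} →
                 n ℕ.+ n ℕ.+ i ℕ.+ j ≡ h ℕ.+ r → n₀ ℕ.+ n₀ ℕ.+ e ℕ.+ 1 ≡ h → c ℕ.+ b ≡ n →
                 e ℕ.+ r ℕ.+ g ℕ.+ g ≡ 1 ℕ.+ i ℕ.+ j → c ℕ.+ b ℕ.+ g ≡ n₀ ℕ.+ 1
exponent-count {n} {n₀} {c} {b} {g} {i} {j} {e} {r} diagonal diagonal₀ c+b≡n boundary =
  ℕ.*-cancelʳ-≡ _ _ 2 (ℕ.+-cancelʳ-≡ (1 ℕ.+ i ℕ.+ j) _ _ (begin
    (c ℕ.+ b ℕ.+ g) ℕ.* 2 ℕ.+ (1 ℕ.+ i ℕ.+ j)
      ≡⟨ cong (λ m → (m ℕ.+ g) ℕ.* 2 ℕ.+ (1 ℕ.+ i ℕ.+ j)) c+b≡n ⟩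
    (n ℕ.+ g) ℕ.* 2 ℕ.+ (1 ℕ.+ i ℕ.+ j)
      ≡⟨ solve 4 (λ n g i j → (n :+ g) :* con 2 :+ (con 1 :+ i :+ j) := (n :+ n :+ i :+ j) :+ (g :+ g :+ con 1))
               refl n g i j ⟩
    (n ℕ.+ n ℕ.+ i ℕ.+ j) ℕ.+ (g ℕ.+ g ℕ.+ 1)
      ≡⟨ cong (ℕ._+ (g ℕ.+ g ℕ.+ 1)) (trans diagonal (cong (ℕ._+ r) (sym diagonal₀))) ⟩
    (n₀ ℕ.+ n₀ ℕ.+ e ℕ.+ 1 ℕ.+ r) ℕ.+ (g ℕ.+ g ℕ.+ 1)
      ≡⟨ solve 4 (λ n₀ e r g → (n₀ :+ n₀ :+ e :+ con 1 :+ r) :+ (g :+ g :+ con 1)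
                                 := (n₀ :+ con 1) :* con 2 :+ (e :+ r :+ g :+ g)) refl n₀ e r g ⟩
    (n₀ ℕ.+ 1) ℕ.* 2 ℕ.+ (e ℕ.+ r ℕ.+ g ℕ.+ g)
      ≡⟨ cong ((n₀ ℕ.+ 1) ℕ.* 2 ℕ.+_) boundary ⟩
    (n₀ ℕ.+ 1) ℕ.* 2 ℕ.+ (1 ℕ.+ i ℕ.+ j) ∎))
  where open +-*-Solver using (solve; _:+_; _:*_; _:=_; con)

-- Finite fields of odd order

module OddFiniteField (F : FiniteField) (odd : order F % 2 ≡ 1) where
  open FiniteField F

  commutativeRing : CommutativeRing _ _
  commutativeRing = record { isCommutativeRing = isCommutativeRing }

  open CommutativeRing commutativeRing
    using (+-assoc; +-comm; +-identityˡ; +-identityʳ; -‿inverseˡ; -‿inverseʳ; *-assoc; *-comm;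
           *-identityˡ; *-identityʳ; distribˡ; distribʳ; zeroˡ; zeroʳ; ring; *-isCommutativeMonoid;
           +-commutativeMonoid; *-commutativeMonoid)
  open import Algebra.Properties.Ring ring
    using (-‿distribˡ-*; -‿distribʳ-*; x∙y⁻¹≈ε⇒x≈y; +-inverseʳ-unique; -‿involutive; -‿+-comm;
           -1*x≈-x; -0#≈0#; +-cancelˡ; [y-z]x≈yx-zx)
  module +-Solver = CommutativeMonoidSolver +-commutativeMonoid
  module *-Solver = CommutativeMonoidSolver *-commutativeMonoid
  open CommutativeSemigroupProperties (CommutativeMonoid.commutativeSemigroup *-commutativeMonoid)
    using () renaming (interchange to *-interchange)
  open BigOperator *-isCommutativeMonoid using (bigop; bigop-cong; bigop-∙; bigop-if; bigop-reindex)
    renaming (_^_ to _^ᴹ_)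

  *-inverseˡ : ∀ x → x ≢ 0# → x ⁻¹ * x ≡ 1#
  *-inverseˡ x x≢0 = trans (*-comm _ _) (*-inverse x x≢0)

  x⁻¹*[x*y]≡y : ∀ x → x ≢ 0# → ∀ y → x ⁻¹ * (x * y) ≡ y
  x⁻¹*[x*y]≡y x x≢0 y = trans (sym (*-assoc _ _ _)) (trans (cong (_* y) (*-inverseˡ x x≢0)) (*-identityˡ y))

  x*[x⁻¹*y]≡y : ∀ x → x ≢ 0# → ∀ y → x * (x ⁻¹ * y) ≡ y
  x*[x⁻¹*y]≡y x x≢0 y = trans (sym (*-assoc _ _ _)) (trans (cong (_* y) (*-inverse x x≢0)) (*-identityˡ y))

  x*y≡0⇒x≡0⊎y≡0 : ∀ x y → x * y ≡ 0# → x ≡ 0# ⊎ y ≡ 0#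
  x*y≡0⇒x≡0⊎y≡0 x y xy≡0 with x ≟ 0#
  ... | yes x≡0 = inj₁ x≡0
  ... | no x≢0 = inj₂ (begin
    y              ≡⟨ x⁻¹*[x*y]≡y x x≢0 y ⟨
    x ⁻¹ * (x * y) ≡⟨ cong (x ⁻¹ *_) xy≡0 ⟩
    x ⁻¹ * 0#      ≡⟨ zeroʳ _ ⟩
    0# ∎)

  *-≢0 : ∀ {x y} → x ≢ 0# → y ≢ 0# → x * y ≢ 0#
  *-≢0 x≢0 y≢0 xy≡0 with x*y≡0⇒x≡0⊎y≡0 _ _ xy≡0
  ... | inj₁ x≡0 = x≢0 x≡0
  ... | inj₂ y≡0 = y≢0 y≡0

  ⁻¹-unique : ∀ x y → x * y ≡ 1# → y ≡ x ⁻¹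
  ⁻¹-unique x y xy≡1 with x ≟ 0#
  ... | yes refl = ⊥-elim (1≢0 (trans (sym xy≡1) (zeroˡ y)))
  ... | no x≢0 = trans (sym (x⁻¹*[x*y]≡y x x≢0 y)) (trans (cong (x ⁻¹ *_) xy≡1) (*-identityʳ _))

  ⁻¹-≢0 : ∀ x → x ≢ 0# → x ⁻¹ ≢ 0#
  ⁻¹-≢0 x x≢0 x⁻¹≡0 = 1≢0 (trans (sym (*-inverse x x≢0)) (trans (cong (x *_) x⁻¹≡0) (zeroʳ x)))

  ⁻¹-involutive : ∀ x → x ≢ 0# → (x ⁻¹) ⁻¹ ≡ x
  ⁻¹-involutive x x≢0 = sym (⁻¹-unique (x ⁻¹) x (*-inverseˡ x x≢0))

  -‿≢0 : ∀ x → x ≢ 0# → - x ≢ 0#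
  -‿≢0 x x≢0 -x≡0 = x≢0 (trans (sym (-‿involutive x)) (trans (cong -_ -x≡0) -0#≈0#))

  -x*-x≡x*x : ∀ x → (- x) * (- x) ≡ x * x
  -x*-x≡x*x x = trans (sym (-‿distribˡ-* x (- x))) (trans (cong -_ (sym (-‿distribʳ-* x x))) (-‿involutive _))

  +-exchange : ∀ a b c d → (a + b) + (c + d) ≡ (a + d) + (b + c)
  +-exchange a b c d = +-Solver.prove 4 ((u ⊕ v) ⊕ (w ⊕ z)) ((u ⊕ z) ⊕ (v ⊕ w)) (a ∷ b ∷ c ∷ d ∷ [])
    where
    open +-Solver using (_⊕_; var)
    u v w z : +-Solver.Expr 4
    u = var (# 0); v = var (# 1); w = var (# 2); z = var (# 3)

  [x-y][x+y]≡x²-y² : ∀ x y → (x + - y) * (x + y) ≡ x * x + - (y * y)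
  [x-y][x+y]≡x²-y² x y = begin
    (x + - y) * (x + y)                       ≡⟨ distribˡ _ x y ⟩
    (x + - y) * x + (x + - y) * y             ≡⟨ cong₂ _+_ ([y-z]x≈yx-zx x x y) ([y-z]x≈yx-zx y x y) ⟩
    (x * x + - (y * x)) + (x * y + - (y * y)) ≡⟨ cong (λ z → (x * x + - z) + (x * y + - (y * y))) (*-comm y x) ⟩
    (x * x + - (x * y)) + (x * y + - (y * y)) ≡⟨ +-exchange _ _ _ _ ⟩
    (x * x + - (y * y)) + (- (x * y) + x * y) ≡⟨ cong (x * x + - (y * y) +_) (-‿inverseˡ _) ⟩
    (x * x + - (y * y)) + 0#                  ≡⟨ +-identityʳ _ ⟩
    x * x + - (y * y) ∎

  x*x≡y*y⇒y≡±x : ∀ x y → x * x ≡ y * y → y ≡ x ⊎ y ≡ - x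
  x*x≡y*y⇒y≡±x x y x²≡y²
    with x*y≡0⇒x≡0⊎y≡0 (x + - y) (x + y)
           (trans ([x-y][x+y]≡x²-y² x y) (trans (cong (_+ - (y * y)) x²≡y²) (-‿inverseʳ _)))
  ... | inj₁ x-y≡0 = inj₁ (sym (x∙y⁻¹≈ε⇒x≈y x y x-y≡0))
  ... | inj₂ x+y≡0 = inj₂ (+-inverseʳ-unique x y x+y≡0)

  x+x≡x*[1+1] : ∀ x → x + x ≡ x * (1# + 1#)
  x+x≡x*[1+1] x = sym (trans (distribˡ x 1# 1#) (cong₂ _+_ (*-identityʳ x) (*-identityʳ x)))

  -- In characteristic 2, x ↦ x (x + 1) is exactly two-to-one with fibres {x, x + 1}, so the order is even.
  module Characteristic2 (1+1≡0 : 1# + 1# ≡ 0#) where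

    x+x≡0 : ∀ x → x + x ≡ 0#
    x+x≡0 x = trans (x+x≡x*[1+1] x) (trans (cong (x *_) 1+1≡0) (zeroʳ x))

    -x≡x : ∀ x → - x ≡ x
    -x≡x x = sym (+-inverseʳ-unique x x (x+x≡0 x))

    x[x+1] : Carrier → Carrier
    x[x+1] x = x * (x + 1#)

    x[x+1]≡x²+x : ∀ x → x[x+1] x ≡ x * x + x
    x[x+1]≡x²+x x = trans (distribˡ x x 1#) (cong (x * x +_) (*-identityʳ x))

    x[x+1]-additive : ∀ x y → x[x+1] (x + y) ≡ x[x+1] x + x[x+1] y
    x[x+1]-additive x y = begin
      (x + y) * ((x + y) + 1#)                      ≡⟨ x[x+1]≡x²+x (x + y) ⟩
      (x + y) * (x + y) + (x + y)                   ≡⟨ cong (_+ (x + y)) [x+y]²≡ ⟩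
      ((x * x + y * x) + (x * y + y * y)) + (x + y) ≡⟨ +-regroup (x * x) (y * x) (x * y) (y * y) x y ⟩
      ((x * x + x) + (y * y + y)) + (y * x + x * y) ≡⟨ cong (((x * x + x) + (y * y + y)) +_) yx+xy≡0 ⟩
      ((x * x + x) + (y * y + y)) + 0#              ≡⟨ +-identityʳ _ ⟩
      (x * x + x) + (y * y + y)                     ≡⟨ cong₂ _+_ (x[x+1]≡x²+x x) (x[x+1]≡x²+x y) ⟨
      x[x+1] x + x[x+1] y ∎
      where
      [x+y]²≡ : (x + y) * (x + y) ≡ (x * x + y * x) + (x * y + y * y)
      [x+y]²≡ = trans (distribˡ _ _ _) (cong₂ _+_ (distribʳ _ _ _) (distribʳ _ _ _))
      yx+xy≡0 : y * x + x * y ≡ 0#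
      yx+xy≡0 = trans (cong (y * x +_) (*-comm x y)) (x+x≡0 _)
      +-regroup : ∀ a b c d e g → ((a + b) + (c + d)) + (e + g) ≡ ((a + e) + (d + g)) + (b + c)
      +-regroup a b c d e g =
        +-Solver.prove 6 (((a′ ⊕ b′) ⊕ (c′ ⊕ d′)) ⊕ (e′ ⊕ g′)) (((a′ ⊕ e′) ⊕ (d′ ⊕ g′)) ⊕ (b′ ⊕ c′))
                         (a ∷ b ∷ c ∷ d ∷ e ∷ g ∷ [])
        where
        open +-Solver using (_⊕_; var)
        a′ b′ c′ d′ e′ g′ : +-Solver.Expr 6
        a′ = var (# 0); b′ = var (# 1); c′ = var (# 2); d′ = var (# 3); e′ = var (# 4); g′ = var (# 5)

    x[x+1]-shift : ∀ x → x[x+1] (x + 1#) ≡ x[x+1] x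
    x[x+1]-shift x = begin
      (x + 1#) * ((x + 1#) + 1#) ≡⟨ cong ((x + 1#) *_) (trans (+-assoc x 1# 1#) (trans (cong (x +_) 1+1≡0) (+-identityʳ x))) ⟩
      (x + 1#) * x               ≡⟨ *-comm _ _ ⟩
      x[x+1] x ∎

    x[x+1]-fibre : ∀ x y → x[x+1] x ≡ x[x+1] y → y ≡ x ⊎ y ≡ x + 1#
    x[x+1]-fibre x y fx≡fy
      with x*y≡0⇒x≡0⊎y≡0 (x + y) ((x + y) + 1#)
             (trans (x[x+1]-additive x y) (trans (cong (x[x+1] x +_) (sym fx≡fy)) (x+x≡0 _)))
    ... | inj₁ x+y≡0 = inj₁ (trans (+-inverseʳ-unique x y x+y≡0) (-x≡x x))
    ... | inj₂ x+y+1≡0 = inj₂ (trans (+-inverseʳ-unique (x + 1#) y (trans [x+1]+y≡[x+y]+1 x+y+1≡0)) (-x≡x _))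
      where
      [x+1]+y≡[x+y]+1 : (x + 1#) + y ≡ (x + y) + 1#
      [x+1]+y≡[x+y]+1 = trans (+-assoc x 1# y) (trans (cong (x +_) (+-comm 1# y)) (sym (+-assoc x y 1#)))

    x+1≢x : ∀ x → x + 1# ≢ x
    x+1≢x x x+1≡x = 1≢0 (+-cancelˡ x 1# 0# (trans x+1≡x (sym (+-identityʳ x))))

    #x[x+1]-values : ℕ
    #x[x+1]-values = count (λ s → does (any? (λ x → x[x+1] x ≟ s) elems)) elems

    order-even : order F ≡ #x[x+1]-values ℕ.+ #x[x+1]-values
    order-even = length-two-to-one _≟_ elems elems-unique elems-complete elems elems-unique x[x+1] (_+ 1#)
                   (λ x _ → elems-complete (x + 1#)) (λ x _ → x+1≢x x) x[x+1]-fibre x[x+1]-shift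

  1+1≢0 : 1# + 1# ≢ 0#
  1+1≢0 1+1≡0 = ℕ.0≢1+n (trans (sym ([n+n]%2≡0 #x[x+1]-values)) (trans (cong (_% 2) (sym order-even)) odd))
    where open Characteristic2 1+1≡0

  -- Squares and the Legendre symbol

  data LegendreView (a : Carrier) : ℤ → Set where
    vanishing : a ≡ 0# → LegendreView a 0ℤ
    square    : a ≢ 0# → (b : Carrier) → b * b ≡ a → LegendreView a 1ℤ
    nonsquare : a ≢ 0# → (∀ b → b * b ≢ a) → LegendreView a -1ℤ

  legendreView : ∀ a → LegendreView a (legendre F a)
  legendreView a with a ≟ 0#
  ... | yes a≡0 = vanishing a≡0
  ... | no a≢0 with any? (λ b → (b * b) ≟ a) elems
  ...   | yes root = let (b , _ , b²≡a) = find root in square a≢0 b b²≡a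
  ...   | no no-root = nonsquare a≢0 (λ b b²≡a → no-root (lose (elems-complete b) b²≡a))

  legendre-zero : ∀ {a} → a ≡ 0# → legendre F a ≡ 0ℤ
  legendre-zero {a} a≡0 with legendre F a | legendreView a
  ... | _ | vanishing _ = refl
  ... | _ | square a≢0 _ _ = ⊥-elim (a≢0 a≡0)
  ... | _ | nonsquare a≢0 _ = ⊥-elim (a≢0 a≡0)

  legendre-square : ∀ {a} → a ≢ 0# → (b : Carrier) → b * b ≡ a → legendre F a ≡ 1ℤ
  legendre-square {a} a≢0 b b²≡a with legendre F a | legendreView a
  ... | _ | vanishing a≡0 = ⊥-elim (a≢0 a≡0)
  ... | _ | square _ _ _ = refl
  ... | _ | nonsquare _ no-root = ⊥-elim (no-root b b²≡a)

  legendre-nonsquare : ∀ {a} → a ≢ 0# → (∀ b → b * b ≢ a) → legendre F a ≡ -1ℤ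
  legendre-nonsquare {a} a≢0 no-root with legendre F a | legendreView a
  ... | _ | vanishing a≡0 = ⊥-elim (a≢0 a≡0)
  ... | _ | square _ b b²≡a = ⊥-elim (no-root b b²≡a)
  ... | _ | nonsquare _ _ = refl

  root-≢0 : ∀ {a} b → a ≢ 0# → b * b ≡ a → b ≢ 0#
  root-≢0 b a≢0 b²≡a b≡0 = a≢0 (trans (sym b²≡a) (trans (cong (_* b) b≡0) (zeroˡ b)))

  legendre-x² : ∀ {x} → x ≢ 0# → legendre F (x * x) ≡ 1ℤ
  legendre-x² {x} x≢0 = legendre-square (*-≢0 x≢0 x≢0) x refl

  isSymbol : ℤ → Carrier → Bool
  isSymbol u a = does (legendre F a ℤ.≟ u)

  #squares : ℕ
  #squares = count (isSymbol 1ℤ) elems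

  #nonzero≡2*#squares : count (λ x → not (does (x ≟ 0#))) elems ≡ #squares ℕ.+ #squares
  #nonzero≡2*#squares = begin
    count (λ x → not (does (x ≟ 0#))) elems ≡⟨ length-filter nonzero? elems ⟨
    length nonzeros                         ≡⟨ length-two-to-one _≟_ elems elems-unique elems-complete nonzeros
                                                 (filter⁺ nonzero? elems-unique) (λ x → x * x) -_ -x∈ -x≢x
                                                 x*x≡y*y⇒y≡±x -x*-x≡x*x ⟩
    #squares-of-nonzeros ℕ.+ #squares-of-nonzeros ≡⟨ cong (λ n → n ℕ.+ n) (count-cong image≡squares elems) ⟩
    #squares ℕ.+ #squares ∎
    where
    nonzero? : (x : Carrier) → Dec (x ≢ 0#)
    nonzero? x = ¬? (x ≟ 0#)
    nonzeros : List Carrier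
    nonzeros = filter nonzero? elems
    nonzero : ∀ {x} → x ∈ nonzeros → x ≢ 0#
    nonzero x∈ = proj₂ (∈-filter⁻ nonzero? {xs = elems} x∈)
    -x∈ : ∀ x → x ∈ nonzeros → - x ∈ nonzeros
    -x∈ x x∈ = ∈-filter⁺ nonzero? (elems-complete (- x)) (-‿≢0 x (nonzero x∈))
    -x≢x : ∀ x → x ∈ nonzeros → - x ≢ x
    -x≢x x x∈ -x≡x with x*y≡0⇒x≡0⊎y≡0 x (1# + 1#)
                          (trans (sym (x+x≡x*[1+1] x)) (trans (cong (x +_) (sym -x≡x)) (-‿inverseʳ x)))
    ... | inj₁ x≡0 = nonzero x∈ x≡0
    ... | inj₂ 1+1≡0 = 1+1≢0 1+1≡0
    #squares-of-nonzeros : ℕ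
    #squares-of-nonzeros = count (λ s → does (any? (λ x → (x * x) ≟ s) nonzeros)) elems
    image≡squares : ∀ s → does (any? (λ x → (x * x) ≟ s) nonzeros) ≡ isSymbol 1ℤ s
    image≡squares s with legendre F s | legendreView s | any? (λ x → (x * x) ≟ s) nonzeros
    ... | _ | vanishing s≡0 | yes root = let (x , x∈ , x²≡s) = find root in
                                         ⊥-elim (*-≢0 (nonzero x∈) (nonzero x∈) (trans x²≡s s≡0))
    ... | _ | vanishing _ | no _ = refl
    ... | _ | square _ _ _ | yes _ = refl
    ... | _ | square s≢0 b b²≡s | no no-root =
      ⊥-elim (no-root (lose (∈-filter⁺ nonzero? (elems-complete b) (root-≢0 b s≢0 b²≡s)) b²≡s))
    ... | _ | nonsquare _ no-root | yes root = let (x , _ , x²≡s) = find root in ⊥-elim (no-root x x²≡s)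
    ... | _ | nonsquare _ _ | no _ = refl

  order≡1+2*#squares : order F ≡ suc (#squares ℕ.+ #squares)
  order≡1+2*#squares = begin
    length elems                                                     ≡⟨ length≡count+count-not (λ x → does (x ≟ 0#)) elems ⟩
    count (λ x → does (x ≟ 0#)) elems ℕ.+ count (λ x → not (does (x ≟ 0#))) elems
      ≡⟨ cong₂ ℕ._+_ #zero≡1 #nonzero≡2*#squares ⟩
    suc (#squares ℕ.+ #squares) ∎
    where
    #zero≡1 : count (λ x → does (x ≟ 0#)) elems ≡ 1
    #zero≡1 = trans (count-cong (λ x → does-⇔ (mk⇔ sym sym) (x ≟ 0#) (0# ≟ x)) elems)
                    (count-≟ _≟_ 0# elems elems-unique (elems-complete 0#))

  #nonsquares≡#squares : count (isSymbol -1ℤ) elems ≡ #squares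
  #nonsquares≡#squares = ℕ.+-cancelˡ-≡ #squares _ _
    (trans (count-+ (isSymbol 1ℤ) (isSymbol -1ℤ) (λ x → not (does (x ≟ 0#))) nonzero-trichotomy elems)
           #nonzero≡2*#squares)
    where
    nonzero-trichotomy : ∀ x → iverson (isSymbol 1ℤ x) ℕ.+ iverson (isSymbol -1ℤ x) ≡ iverson (not (does (x ≟ 0#)))
    nonzero-trichotomy x with legendre F x | legendreView x
    ... | _ | vanishing x≡0 rewrite dec-true (x ≟ 0#) x≡0 = refl
    ... | _ | square x≢0 _ _ rewrite dec-false (x ≟ 0#) x≢0 = refl
    ... | _ | nonsquare x≢0 _ rewrite dec-false (x ≟ 0#) x≢0 = refl

  square*nonsquare : ∀ b c → b ≢ 0# → (∀ e → e * e ≢ c) → ∀ e → e * e ≢ (b * b) * c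
  square*nonsquare b c b≢0 c-nonsquare e e²≡b²c = c-nonsquare (e * b ⁻¹) (begin
    (e * b ⁻¹) * (e * b ⁻¹)            ≡⟨ *-interchange e (b ⁻¹) e (b ⁻¹) ⟩
    (e * e) * (b ⁻¹ * b ⁻¹)            ≡⟨ cong (_* (b ⁻¹ * b ⁻¹)) e²≡b²c ⟩
    ((b * b) * c) * (b ⁻¹ * b ⁻¹)      ≡⟨ *-regroup b c (b ⁻¹) ⟩
    ((b * b ⁻¹) * (b * b ⁻¹)) * c      ≡⟨ cong (λ u → (u * u) * c) (*-inverse b b≢0) ⟩
    (1# * 1#) * c                      ≡⟨ trans (cong (_* c) (*-identityˡ 1#)) (*-identityˡ c) ⟩
    c ∎)
    where
    *-regroup : ∀ x y z → ((x * x) * y) * (z * z) ≡ ((x * z) * (x * z)) * y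
    *-regroup x y z =
      *-Solver.prove 3 (((x′ ⊕ x′) ⊕ y′) ⊕ (z′ ⊕ z′)) (((x′ ⊕ z′) ⊕ (x′ ⊕ z′)) ⊕ y′) (x ∷ y ∷ z ∷ [])
      where
      open *-Solver using (_⊕_; var)
      x′ y′ z′ : *-Solver.Expr 3
      x′ = var (# 0); y′ = var (# 1); z′ = var (# 2)

  -- Multiplication by a nonsquare n permutes F, so exactly #squares elements x have n x nonsquare;
  -- every square x is among them, hence no nonsquare x is.
  nonsquare*nonsquare : ∀ n c → n ≢ 0# → (∀ e → e * e ≢ n) → c ≢ 0# → (∀ e → e * e ≢ c) →
                        legendre F (n * c) ≡ 1ℤ
  nonsquare*nonsquare n c n≢0 n-nonsquare c≢0 c-nonsquare = product-square (legendreView (n * c))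
    where
    shifted-nonsquare : Carrier → Bool
    shifted-nonsquare x = isSymbol -1ℤ (n * x)
    #shifted≡#squares : count shifted-nonsquare elems ≡ #squares
    #shifted≡#squares = trans (count-reindex _≟_ elems elems-unique elems-complete (n *_) (n ⁻¹ *_)
                                 (x*[x⁻¹*y]≡y n n≢0) (x⁻¹*[x*y]≡y n n≢0) (isSymbol -1ℤ))
                              #nonsquares≡#squares
    square⇒shifted : ∀ x → shifted-nonsquare x ∧ isSymbol 1ℤ x ≡ isSymbol 1ℤ x
    square⇒shifted x with legendre F x | legendreView x
    ... | _ | vanishing _ = ∧-zeroʳ _
    ... | _ | nonsquare _ _ = ∧-zeroʳ _
    ... | _ | square x≢0 b b²≡x
      rewrite legendre-nonsquare (*-≢0 n≢0 x≢0)
                (λ e e²≡nx → square*nonsquare b n (root-≢0 b x≢0 b²≡x) n-nonsquare e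
                               (trans e²≡nx (trans (*-comm n x) (cong (_* n) (sym b²≡x))))) = refl
    bad : Carrier → Bool
    bad x = shifted-nonsquare x ∧ not (isSymbol 1ℤ x)
    #bad≡0 : count bad elems ≡ 0
    #bad≡0 = ℕ.+-cancelˡ-≡ #squares _ _ (begin
      #squares ℕ.+ count bad elems
        ≡⟨ cong (ℕ._+ count bad elems) (count-cong square⇒shifted elems) ⟨
      count (λ x → shifted-nonsquare x ∧ isSymbol 1ℤ x) elems ℕ.+ count bad elems
        ≡⟨ count-+ _ _ shifted-nonsquare (λ x → iverson-split (shifted-nonsquare x) (isSymbol 1ℤ x)) elems ⟩
      count shifted-nonsquare elems ≡⟨ #shifted≡#squares ⟩
      #squares                      ≡⟨ ℕ.+-identityʳ #squares ⟨
      #squares ℕ.+ 0 ∎)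
      where
      iverson-split : ∀ a b → iverson (a ∧ b) ℕ.+ iverson (a ∧ not b) ≡ iverson a
      iverson-split true true = refl
      iverson-split true false = refl
      iverson-split false b = refl
    c-bad : legendre F (n * c) ≡ -1ℤ → bad c ≡ true
    c-bad χ[nc]≡-1 =
      cong₂ (λ s t → does (s ℤ.≟ -1ℤ) ∧ not (does (t ℤ.≟ 1ℤ))) χ[nc]≡-1 (legendre-nonsquare c≢0 c-nonsquare)
    product-square : ∀ {s} → LegendreView (n * c) s → s ≡ 1ℤ
    product-square (vanishing nc≡0) = ⊥-elim (*-≢0 n≢0 c≢0 nc≡0)
    product-square (square _ _ _) = refl
    product-square (nonsquare nc≢0 nc-nonsquare)
      with trans (sym (c-bad (legendre-nonsquare nc≢0 nc-nonsquare))) (count-≡0⇒false bad elems #bad≡0 c (elems-complete c))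
    ... | ()

  legendre-* : ∀ a c → legendre F (a * c) ≡ legendre F a ℤ.* legendre F c
  legendre-* a c with legendre F a | legendreView a | legendre F c | legendreView c
  ... | _ | vanishing a≡0 | _ | _ = legendre-zero (trans (cong (_* c) a≡0) (zeroˡ c))
  ... | _ | square _ _ _ | _ | vanishing c≡0 = legendre-zero (trans (cong (a *_) c≡0) (zeroʳ a))
  ... | _ | nonsquare _ _ | _ | vanishing c≡0 = legendre-zero (trans (cong (a *_) c≡0) (zeroʳ a))
  ... | _ | square a≢0 b b²≡a | _ | square c≢0 d d²≡c =
    legendre-square (*-≢0 a≢0 c≢0) (b * d) (trans (*-interchange b d b d) (cong₂ _*_ b²≡a d²≡c))
  ... | _ | square a≢0 b b²≡a | _ | nonsquare c≢0 c-nonsquare =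
    legendre-nonsquare (*-≢0 a≢0 c≢0)
      (λ e e²≡ac → square*nonsquare b c (root-≢0 b a≢0 b²≡a) c-nonsquare e (trans e²≡ac (cong (_* c) (sym b²≡a))))
  ... | _ | nonsquare a≢0 a-nonsquare | _ | square c≢0 d d²≡c =
    legendre-nonsquare (*-≢0 a≢0 c≢0)
      (λ e e²≡ac → square*nonsquare d a (root-≢0 d c≢0 d²≡c) a-nonsquare e
                     (trans e²≡ac (trans (*-comm a c) (cong (_* a) (sym d²≡c)))))
  ... | _ | nonsquare a≢0 a-nonsquare | _ | nonsquare c≢0 c-nonsquare =
    nonsquare*nonsquare a c a≢0 a-nonsquare c≢0 c-nonsquare

  legendre-symbol : ∀ a → Symbol (legendre F a)
  legendre-symbol a with legendre F a | legendreView a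
  ... | _ | vanishing _ = zero
  ... | _ | square _ _ _ = plus
  ... | _ | nonsquare _ _ = minus

  legendre-sign : ∀ {a} → a ≢ 0# → Sign (legendre F a)
  legendre-sign {a} a≢0 with legendre F a | legendreView a
  ... | _ | vanishing a≡0 = ⊥-elim (a≢0 a≡0)
  ... | _ | square _ _ _ = plus
  ... | _ | nonsquare _ _ = minus

  ε : ℤ
  ε = epsilon F

  ε-sign : Sign ε
  ε-sign = legendre-sign (-‿≢0 1# 1≢0)

  legendre-neg : ∀ x → legendre F (- x) ≡ ε ℤ.* legendre F x
  legendre-neg x = trans (cong (legendre F) (sym (-1*x≈-x x))) (legendre-* (- 1#) x)

  #symbol≡#squares : ∀ {u} → Sign u → count (isSymbol u) elems ≡ #squares
  #symbol≡#squares plus = refl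
  #symbol≡#squares minus = #nonsquares≡#squares

  -- Pairs of Legendre symbols

  [x-c]+c≡x : ∀ c x → (x + - c) + c ≡ x
  [x-c]+c≡x c x = trans (+-assoc x (- c) c) (trans (cong (x +_) (-‿inverseˡ c)) (+-identityʳ x))

  [x+c]-c≡x : ∀ c x → (x + c) + - c ≡ x
  [x+c]-c≡x c x = trans (+-assoc x c (- c)) (trans (cong (x +_) (-‿inverseʳ c)) (+-identityʳ x))

  #symbol-translate : ∀ c u → count (λ a → isSymbol u (a + c)) elems ≡ count (isSymbol u) elems
  #symbol-translate c u = count-reindex _≟_ elems elems-unique elems-complete (_+ c) (_+ - c)
                            ([x-c]+c≡x c) ([x+c]-c≡x c) (isSymbol u)

  isSymbol0[a+c]≡[-c≟a] : ∀ c a → isSymbol 0ℤ (a + c) ≡ does ((- c) ≟ a)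
  isSymbol0[a+c]≡[-c≟a] c a = does-⇔ (mk⇔ ⇒ ⇐) (legendre F (a + c) ℤ.≟ 0ℤ) ((- c) ≟ a)
    where
    ⇒ : legendre F (a + c) ≡ 0ℤ → - c ≡ a
    ⇒ symbol≡0 with legendre F (a + c) | legendreView (a + c)
    ⇒ refl | _ | vanishing a+c≡0 = sym (+-inverseʳ-unique c a (trans (+-comm c a) a+c≡0))
    ⇐ : - c ≡ a → legendre F (a + c) ≡ 0ℤ
    ⇐ refl = legendre-zero (-‿inverseˡ c)

  -- Unlike the sets S, this counts a = 0 as well.
  pairCount : Carrier → Carrier → ℤ → ℤ → ℕ
  pairCount k l u v = count (λ a → isSymbol u (a + k) ∧ isSymbol v (a + l)) elems

  pairCount-swap : ∀ k l u v → pairCount k l u v ≡ pairCount l k v u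
  pairCount-swap k l u v = count-cong (λ a → ∧-comm (isSymbol u (a + k)) (isSymbol v (a + l))) elems

  pairCount-row : ∀ k l {u v} → Sign u → Sign v →
                  pairCount k l u v ℕ.+ pairCount k l u (ℤ.- v) ℕ.+ iverson (isSymbol u (- l + k)) ≡ #squares
  pairCount-row k l {u} {v} sign-u sign-v = begin
    n₂ ℕ.+ iverson (isSymbol u (- l + k))
      ≡⟨ cong (n₂ ℕ.+_) (count-∧-≟ _≟_ (- l) elems elems-unique (elems-complete _) first) ⟨
    n₂ ℕ.+ count (λ a → first a ∧ does ((- l) ≟ a)) elems
      ≡⟨ cong (n₂ ℕ.+_) (count-cong (λ a → cong (first a ∧_) (isSymbol0[a+c]≡[-c≟a] l a)) elems) ⟨
    n₂ ℕ.+ count (λ a → first a ∧ isSymbol 0ℤ (a + l)) elems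
      ≡⟨ count-+₃ _ _ _ first (λ a → row-split (first a) (legendre-symbol (a + l)) sign-v) elems ⟩
    count first elems        ≡⟨ #symbol-translate k u ⟩
    count (isSymbol u) elems ≡⟨ #symbol≡#squares sign-u ⟩
    #squares ∎
    where
    n₂ : ℕ
    n₂ = pairCount k l u v ℕ.+ pairCount k l u (ℤ.- v)
    first : Carrier → Bool
    first a = isSymbol u (a + k)
    row-split : ∀ b {y w} → Symbol y → Sign w →
                iverson (b ∧ does (y ℤ.≟ w)) ℕ.+ iverson (b ∧ does (y ℤ.≟ ℤ.- w)) ℕ.+ iverson (b ∧ does (y ℤ.≟ 0ℤ))
                  ≡ iverson b
    row-split false _ _ = refl
    row-split true zero plus = refl
    row-split true zero minus = refl
    row-split true plus plus = refl
    row-split true plus minus = refl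
    row-split true minus plus = refl
    row-split true minus minus = refl

  pairCount-column : ∀ k l {u v} → Sign u → Sign v →
                     pairCount k l u v ℕ.+ pairCount k l (ℤ.- u) v ℕ.+ iverson (isSymbol v (- k + l)) ≡ #squares
  pairCount-column k l {u} {v} sign-u sign-v = begin
    pairCount k l u v ℕ.+ pairCount k l (ℤ.- u) v ℕ.+ iverson (isSymbol v (- k + l))
      ≡⟨ cong₂ (λ m n → m ℕ.+ n ℕ.+ iverson (isSymbol v (- k + l)))
               (pairCount-swap k l u v) (pairCount-swap k l (ℤ.- u) v) ⟩
    pairCount l k v u ℕ.+ pairCount l k v (ℤ.- u) ℕ.+ iverson (isSymbol v (- k + l))
      ≡⟨ pairCount-row l k sign-v sign-u ⟩
    #squares ∎

  inv₀ : Carrier → Carrier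
  inv₀ t with t ≟ 0#
  ... | yes _ = 0#
  ... | no _ = t ⁻¹

  inv₀-0 : inv₀ 0# ≡ 0#
  inv₀-0 with 0# ≟ 0#
  ... | yes _ = refl
  ... | no 0≢0 = ⊥-elim (0≢0 refl)

  inv₀-≢0 : ∀ {t} → t ≢ 0# → inv₀ t ≡ t ⁻¹
  inv₀-≢0 {t} t≢0 with t ≟ 0#
  ... | yes t≡0 = ⊥-elim (t≢0 t≡0)
  ... | no _ = refl

  inv₀-involutive : ∀ t → inv₀ (inv₀ t) ≡ t
  inv₀-involutive t with t ≟ 0#
  ... | yes refl = inv₀-0
  ... | no t≢0 = trans (inv₀-≢0 (⁻¹-≢0 t t≢0)) (⁻¹-involutive t t≢0)

  module _ (D : Carrier) (D≢0 : D ≢ 0#) where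

    1+D/t : Carrier → Carrier
    1+D/t t = 1# + D * inv₀ t

    1+D/t-inverse : Carrier → Carrier
    1+D/t-inverse x = inv₀ (D ⁻¹ * (x + - 1#))

    1+D/t-rightInverse : ∀ x → 1+D/t (1+D/t-inverse x) ≡ x
    1+D/t-rightInverse x = begin
      1# + D * inv₀ (inv₀ (D ⁻¹ * (x + - 1#))) ≡⟨ cong (λ z → 1# + D * z) (inv₀-involutive _) ⟩
      1# + D * (D ⁻¹ * (x + - 1#))             ≡⟨ cong (1# +_) (x*[x⁻¹*y]≡y D D≢0 _) ⟩
      1# + (x + - 1#)                          ≡⟨ trans (+-comm _ _) ([x-c]+c≡x 1# x) ⟩
      x ∎

    1+D/t-leftInverse : ∀ t → 1+D/t-inverse (1+D/t t) ≡ t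
    1+D/t-leftInverse t = begin
      inv₀ (D ⁻¹ * ((1# + D * inv₀ t) + - 1#)) ≡⟨ cong (λ z → inv₀ (D ⁻¹ * (z + - 1#))) (+-comm 1# _) ⟩
      inv₀ (D ⁻¹ * ((D * inv₀ t + 1#) + - 1#)) ≡⟨ cong (λ z → inv₀ (D ⁻¹ * z)) ([x+c]-c≡x 1# _) ⟩
      inv₀ (D ⁻¹ * (D * inv₀ t))               ≡⟨ cong inv₀ (x⁻¹*[x*y]≡y D D≢0 _) ⟩
      inv₀ (inv₀ t)                            ≡⟨ inv₀-involutive t ⟩
      t ∎

    1+D/0≡1 : 1+D/t 0# ≡ 1#
    1+D/0≡1 = trans (cong (λ z → 1# + D * z) inv₀-0) (trans (cong (1# +_) (zeroʳ D)) (+-identityʳ 1#))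

    t[t+D]≡t²[1+D/t] : ∀ {t} → t ≢ 0# → t * (t + D) ≡ (t * t) * 1+D/t t
    t[t+D]≡t²[1+D/t] {t} t≢0 = sym (begin
      (t * t) * (1# + D * inv₀ t)           ≡⟨ distribˡ _ _ _ ⟩
      (t * t) * 1# + (t * t) * (D * inv₀ t) ≡⟨ cong₂ _+_ (*-identityʳ _) (cong (λ z → t * t * (D * z)) (inv₀-≢0 t≢0)) ⟩
      t * t + (t * t) * (D * t ⁻¹)          ≡⟨ cong (t * t +_) (*-interchange t t D (t ⁻¹)) ⟩
      t * t + (t * D) * (t * t ⁻¹)          ≡⟨ cong (λ z → t * t + (t * D) * z) (*-inverse t t≢0) ⟩
      t * t + (t * D) * 1#                  ≡⟨ cong (t * t +_) (*-identityʳ _) ⟩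
      t * t + t * D                         ≡⟨ distribˡ _ _ _ ⟨
      t * (t + D) ∎)

    -- t ↦ 1 + D/t is a bijection of F carrying the symbol of t (t + D) for t ≠ 0, and 0 to 1.
    #symbol-t[t+D] : ∀ {w} → Sign w →
                     count (λ t → isSymbol w (t * (t + D))) elems ℕ.+ iverson (does (1ℤ ℤ.≟ w)) ≡ #squares
    #symbol-t[t+D] {w} sign-w = begin
      count (λ t → isSymbol w (t * (t + D))) elems ℕ.+ iverson (does (1ℤ ℤ.≟ w))
        ≡⟨ cong (count (λ t → isSymbol w (t * (t + D))) elems ℕ.+_)
                (count-∧-≟ _≟_ 0# elems elems-unique (elems-complete _) (λ _ → does (1ℤ ℤ.≟ w))) ⟨
      count (λ t → isSymbol w (t * (t + D))) elems ℕ.+ count (λ t → does (1ℤ ℤ.≟ w) ∧ does (0# ≟ t)) elems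
        ≡⟨ count-+ _ _ (isSymbol w ∘ 1+D/t) pointwise elems ⟩
      count (isSymbol w ∘ 1+D/t) elems
        ≡⟨ count-reindex _≟_ elems elems-unique elems-complete 1+D/t 1+D/t-inverse
                         1+D/t-rightInverse 1+D/t-leftInverse (isSymbol w) ⟩
      count (isSymbol w) elems ≡⟨ #symbol≡#squares sign-w ⟩
      #squares ∎
      where
      pointwise : ∀ t → iverson (isSymbol w (t * (t + D))) ℕ.+ iverson (does (1ℤ ℤ.≟ w) ∧ does (0# ≟ t))
                          ≡ iverson (isSymbol w (1+D/t t))
      pointwise t with 0# ≟ t
      ... | yes refl rewrite legendre-zero (zeroˡ (0# + D)) | 1+D/0≡1 | legendre-square 1≢0 1# (*-identityˡ 1#) =
        at-zero sign-w
        where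
        at-zero : ∀ {s} → Sign s →
                  iverson (does (0ℤ ℤ.≟ s)) ℕ.+ iverson (does (1ℤ ℤ.≟ s) ∧ true) ≡ iverson (does (1ℤ ℤ.≟ s))
        at-zero plus = refl
        at-zero minus = refl
      ... | no 0≢t = begin
        iverson (isSymbol w (t * (t + D))) ℕ.+ iverson (does (1ℤ ℤ.≟ w) ∧ false)
          ≡⟨ cong (λ b → iverson (isSymbol w (t * (t + D))) ℕ.+ iverson b) (∧-zeroʳ _) ⟩
        iverson (isSymbol w (t * (t + D))) ℕ.+ 0     ≡⟨ ℕ.+-identityʳ _ ⟩
        iverson (isSymbol w (t * (t + D)))           ≡⟨ cong (iverson ∘ isSymbol w) (t[t+D]≡t²[1+D/t] t≢0) ⟩
        iverson (isSymbol w ((t * t) * 1+D/t t))     ≡⟨ cong (λ s → iverson (does (s ℤ.≟ w))) (legendre-* (t * t) (1+D/t t)) ⟩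
        iverson (does (legendre F (t * t) ℤ.* legendre F (1+D/t t) ℤ.≟ w))
          ≡⟨ cong (λ s → iverson (does (s ℤ.* legendre F (1+D/t t) ℤ.≟ w))) (legendre-x² t≢0) ⟩
        iverson (does (1ℤ ℤ.* legendre F (1+D/t t) ℤ.≟ w))
          ≡⟨ cong (λ s → iverson (does (s ℤ.≟ w))) (ℤ.*-identityˡ (legendre F (1+D/t t))) ⟩
        iverson (isSymbol w (1+D/t t)) ∎
        where
        t≢0 : t ≢ 0#
        t≢0 t≡0 = 0≢t (sym t≡0)

  pairCount-antidiagonal : ∀ k l → k ≢ l → ∀ {u v} → Sign u → Sign v →
                           pairCount k l u (ℤ.- v) ℕ.+ pairCount k l (ℤ.- u) v ℕ.+ iverson (does (1ℤ ℤ.≟ ℤ.- (u ℤ.* v)))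
                             ≡ #squares
  pairCount-antidiagonal k l k≢l {u} {v} sign-u sign-v = begin
    pairCount k l u (ℤ.- v) ℕ.+ pairCount k l (ℤ.- u) v ℕ.+ iverson (does (1ℤ ℤ.≟ w))
      ≡⟨ cong (ℕ._+ iverson (does (1ℤ ℤ.≟ w))) (count-+ _ _ product-symbol pointwise elems) ⟩
    count product-symbol elems ℕ.+ iverson (does (1ℤ ℤ.≟ w))
      ≡⟨ cong (ℕ._+ iverson (does (1ℤ ℤ.≟ w))) shift ⟩
    count (λ t → isSymbol w (t * (t + D))) elems ℕ.+ iverson (does (1ℤ ℤ.≟ w))
      ≡⟨ #symbol-t[t+D] D D≢0 (Sign-neg {u ℤ.* v} (Sign-* sign-u sign-v)) ⟩
    #squares ∎
    where
    w : ℤ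
    w = ℤ.- (u ℤ.* v)
    D : Carrier
    D = k + - l
    D≢0 : D ≢ 0#
    D≢0 D≡0 = k≢l (x∙y⁻¹≈ε⇒x≈y k l D≡0)
    product-symbol : Carrier → Bool
    product-symbol a = isSymbol w ((a + k) * (a + l))
    pointwise : ∀ a → iverson (isSymbol u (a + k) ∧ isSymbol (ℤ.- v) (a + l))
                        ℕ.+ iverson (isSymbol (ℤ.- u) (a + k) ∧ isSymbol v (a + l))
                        ≡ iverson (product-symbol a)
    pointwise a = trans (product-split (legendre-symbol (a + k)) (legendre-symbol (a + l)) sign-u sign-v)
                        (cong (λ s → iverson (does (s ℤ.≟ w))) (sym (legendre-* (a + k) (a + l))))
    shift : count product-symbol elems ≡ count (λ t → isSymbol w (t * (t + D))) elems
    shift = begin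
      count product-symbol elems
        ≡⟨ count-reindex _≟_ elems elems-unique elems-complete (_+ - l) (_+ l) ([x+c]-c≡x l) ([x-c]+c≡x l) product-symbol ⟨
      count (λ t → product-symbol (t + - l)) elems ≡⟨ count-cong (λ t → cong (isSymbol w) (shifted-product t)) elems ⟩
      count (λ t → isSymbol w (t * (t + D))) elems ∎
      where
      shifted-product : ∀ t → ((t + - l) + k) * ((t + - l) + l) ≡ t * (t + D)
      shifted-product t = trans (cong₂ _*_ t-l+k≡t+D ([x-c]+c≡x l t)) (*-comm _ _)
        where
        t-l+k≡t+D : (t + - l) + k ≡ t + D
        t-l+k≡t+D = trans (+-assoc t (- l) k) (cong (t +_) (+-comm (- l) k))

  pairCount-diagonal : ∀ k l → k ≢ l → ∀ {u v} → Sign u → Sign v →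
                       pairCount k l u v ℕ.+ pairCount k l u v ℕ.+ iverson (isSymbol u (- l + k)) ℕ.+ iverson (isSymbol v (- k + l))
                         ≡ #squares ℕ.+ iverson (does (1ℤ ℤ.≟ ℤ.- (u ℤ.* v)))
  pairCount-diagonal k l k≢l {u} {v} sign-u sign-v =
    double-count {n = pairCount k l u v} {a = pairCount k l u (ℤ.- v)} {b = pairCount k l (ℤ.- u) v}
                 (pairCount-row k l sign-u sign-v) (pairCount-column k l sign-u sign-v)
                 (pairCount-antidiagonal k l k≢l sign-u sign-v)

  pairCount₀-diagonal : pairCount 0# 1# 1ℤ 1ℤ ℕ.+ pairCount 0# 1# 1ℤ 1ℤ ℕ.+ iverson (does (ε ℤ.≟ 1ℤ)) ℕ.+ 1
                          ≡ #squares
  pairCount₀-diagonal = begin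
    n₀ ℕ.+ n₀ ℕ.+ iverson (does (ε ℤ.≟ 1ℤ)) ℕ.+ 1
      ≡⟨ cong₂ (λ i j → n₀ ℕ.+ n₀ ℕ.+ iverson i ℕ.+ iverson j)
               (cong (isSymbol 1ℤ) (sym (+-identityʳ (- 1#))))
               (sym (cong (λ s → does (s ℤ.≟ 1ℤ)) (legendre-square -0+1≢0 1# (trans (*-identityˡ 1#) (sym -0+1≡1))))) ⟩
    n₀ ℕ.+ n₀ ℕ.+ iverson (isSymbol 1ℤ (- 1# + 0#)) ℕ.+ iverson (isSymbol 1ℤ (- 0# + 1#))
      ≡⟨ pairCount-diagonal 0# 1# (λ 0≡1 → 1≢0 (sym 0≡1)) plus plus ⟩
    #squares ℕ.+ 0 ≡⟨ ℕ.+-identityʳ #squares ⟩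
    #squares ∎
    where
    n₀ : ℕ
    n₀ = pairCount 0# 1# 1ℤ 1ℤ
    -0+1≡1 : - 0# + 1# ≡ 1#
    -0+1≡1 = trans (cong (_+ 1#) -0#≈0#) (+-identityˡ 1#)
    -0+1≢0 : - 0# + 1# ≢ 0#
    -0+1≢0 eq = 1≢0 (trans (sym -0+1≡1) eq)

  m≡1+pairCount₀ : mm F ≡ ℤ.+ (pairCount 0# 1# 1ℤ 1ℤ ℕ.+ 1)
  m≡1+pairCount₀ = begin
    (ℤ.+ order F ℤ.- ε) ℤ./ ℤ.+ 4                     ≡⟨ cong (λ q → (ℤ.+ q ℤ.- ε) ℤ./ ℤ.+ 4) order≡1+2*#squares ⟩
    (ℤ.+ suc (#squares ℕ.+ #squares) ℤ.- ε) ℤ./ ℤ.+ 4 ≡⟨ [1+2h-E]/4 ε-sign pairCount₀-diagonal ⟩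
    ℤ.+ (pairCount 0# 1# 1ℤ 1ℤ ℕ.+ 1) ∎

  -- Products over S and T

  inS : Carrier → Carrier → ℤ → ℤ → Carrier → Bool
  inS k l u v a = not (does (a ≟ 0#)) ∧ (isSymbol u (a + k) ∧ isSymbol v (a + l))

  prodL-filter : {P : Carrier → Set} (P? : Decidable P) (xs : List Carrier) →
                 prodL F (filter P? xs) ≡ bigop xs (λ a → if does (P? a) then a else 1#)
  prodL-filter P? [] = refl
  prodL-filter P? (x ∷ xs) with does (P? x)
  ... | true = cong (x *_) (prodL-filter P? xs)
  ... | false = trans (prodL-filter P? xs) (sym (*-identityˡ _))

  prodS-as-bigop : ∀ k l u v → prodS F k l u v ≡ bigop elems (λ a → if inS k l u v a then a else 1#)
  prodS-as-bigop k l u v = prodL-filter _ elems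

  ^ᴹ≡pow : ∀ x n → x ^ᴹ n ≡ pow F x n
  ^ᴹ≡pow x zero = refl
  ^ᴹ≡pow x (suc n) = cong (x *_) (^ᴹ≡pow x n)

  prodT≡prodS : ∀ j l u v → prodT F j l u v ≡ prodS F (- j) l (ε ℤ.* u) v
  prodT≡prodS j l u v = begin
    prodT F j l u v
      ≡⟨ prodL-filter _ elems ⟩
    bigop elems (λ a → if inT a then a else 1#)
      ≡⟨ bigop-cong elems (λ a → cong (λ b → if b then a else 1#) (inT≡inS a)) ⟩
    bigop elems (λ a → if inS (- j) l (ε ℤ.* u) v a then a else 1#)
      ≡⟨ prodS-as-bigop (- j) l (ε ℤ.* u) v ⟨
    prodS F (- j) l (ε ℤ.* u) v ∎
    where
    inT : Carrier → Bool
    inT a = not (does (a ≟ 0#)) ∧ (isSymbol u (j + - a) ∧ isSymbol v (l + a))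
    a-j≡-[j-a] : ∀ a → a + - j ≡ - (j + - a)
    a-j≡-[j-a] a = begin
      a + - j      ≡⟨ +-comm a (- j) ⟩
      - j + a      ≡⟨ cong (- j +_) (-‿involutive a) ⟨
      - j + - - a  ≡⟨ -‿+-comm j (- a) ⟩
      - (j + - a) ∎
    inT≡inS : ∀ a → inT a ≡ inS (- j) l (ε ℤ.* u) v a
    inT≡inS a = cong₂ (λ b b′ → not (does (a ≟ 0#)) ∧ (b ∧ b′))
      (trans (does-≟-*sign ε-sign (legendre F (j + - a)) u)
             (cong (λ s → does (s ℤ.≟ ε ℤ.* u))
                   (sym (trans (cong (legendre F) (a-j≡-[j-a] a)) (legendre-neg _)))))
      (cong (isSymbol v) (+-comm l a))

  isSymbol-rescale : ∀ {c} → c ≢ 0# → ∀ u b k →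
                     isSymbol u (c * b + k) ≡ isSymbol (legendre F c ℤ.* u) (b + _/F_ F k c)
  isSymbol-rescale {c} c≢0 u b k = begin
    does (legendre F (c * b + k) ℤ.≟ u)                       ≡⟨ cong (λ x → does (legendre F x ℤ.≟ u)) c[b+k/c]≡cb+k ⟨
    does (legendre F (c * (b + _/F_ F k c)) ℤ.≟ u)            ≡⟨ cong (λ s → does (s ℤ.≟ u)) (legendre-* c _) ⟩
    does (legendre F c ℤ.* legendre F (b + _/F_ F k c) ℤ.≟ u) ≡⟨ does-*sign-≟ (legendre-sign c≢0) _ u ⟩
    does (legendre F (b + _/F_ F k c) ℤ.≟ legendre F c ℤ.* u) ∎
    where
    c[b+k/c]≡cb+k : c * (b + _/F_ F k c) ≡ c * b + k
    c[b+k/c]≡cb+k =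
      trans (distribˡ c b _) (cong (c * b +_) (trans (cong (c *_) (*-comm k _)) (x*[x⁻¹*y]≡y c c≢0 k)))

  -- a ↦ c a maps S_{k/c, l/c}^{χ(c)u, χ(c)v} onto S_{k,l}^{u,v}, multiplying each element by c.
  prodS-rescale : ∀ {c} → c ≢ 0# → ∀ k l u v →
                  let χc = legendre F c
                  in prodS F k l u v ≡ pow F c (length (SSet F k l u v)) * prodS F (_/F_ F k c) (_/F_ F l c) (χc ℤ.* u) (χc ℤ.* v)
  prodS-rescale {c} c≢0 k l u v = begin
    prodS F k l u v
      ≡⟨ prodS-as-bigop k l u v ⟩
    bigop elems (λ a → if inS k l u v a then a else 1#)
      ≡⟨ bigop-reindex _≟_ elems elems-unique elems-complete (c *_) (c ⁻¹ *_) (x*[x⁻¹*y]≡y c c≢0) (x⁻¹*[x*y]≡y c c≢0) _ ⟨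
    bigop elems (λ b → if inS k l u v (c * b) then c * b else 1#)
      ≡⟨ bigop-cong elems (λ b → cong (λ t → if t then c * b else 1#) (inS-rescale b)) ⟩
    bigop elems (λ b → if Q b then c * b else 1#)
      ≡⟨ bigop-cong elems split ⟩
    bigop elems (λ b → (if Q b then c else 1#) * (if Q b then b else 1#))
      ≡⟨ bigop-∙ elems _ _ ⟩
    bigop elems (λ b → if Q b then c else 1#) * bigop elems (λ b → if Q b then b else 1#)
      ≡⟨ cong₂ _*_ (trans (bigop-if elems Q c) (trans (cong (c ^ᴹ_) #Q≡#S) (^ᴹ≡pow c (length (SSet F k l u v)))))
                   (sym (prodS-as-bigop (_/F_ F k c) (_/F_ F l c) (χc ℤ.* u) (χc ℤ.* v))) ⟩
    pow F c (length (SSet F k l u v)) * prodS F (_/F_ F k c) (_/F_ F l c) (χc ℤ.* u) (χc ℤ.* v) ∎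
    where
    χc : ℤ
    χc = legendre F c
    Q : Carrier → Bool
    Q = inS (_/F_ F k c) (_/F_ F l c) (χc ℤ.* u) (χc ℤ.* v)
    cb≡0⇔b≡0 : ∀ b → does ((c * b) ≟ 0#) ≡ does (b ≟ 0#)
    cb≡0⇔b≡0 b = does-⇔ (mk⇔ cb≡0⇒b≡0 (λ b≡0 → trans (cong (c *_) b≡0) (zeroʳ c))) ((c * b) ≟ 0#) (b ≟ 0#)
      where
      cb≡0⇒b≡0 : c * b ≡ 0# → b ≡ 0#
      cb≡0⇒b≡0 cb≡0 with x*y≡0⇒x≡0⊎y≡0 c b cb≡0
      ... | inj₁ c≡0 = ⊥-elim (c≢0 c≡0)
      ... | inj₂ b≡0 = b≡0
    inS-rescale : ∀ b → inS k l u v (c * b) ≡ Q b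
    inS-rescale b = cong₂ (λ z t → not z ∧ t) (cb≡0⇔b≡0 b)
                          (cong₂ _∧_ (isSymbol-rescale c≢0 u b k) (isSymbol-rescale c≢0 v b l))
    split : ∀ b → (if Q b then c * b else 1#) ≡ (if Q b then c else 1#) * (if Q b then b else 1#)
    split b with Q b
    ... | true = refl
    ... | false = sym (*-identityˡ 1#)
    #Q≡#S : count Q elems ≡ length (SSet F k l u v)
    #Q≡#S = begin
      count Q elems                       ≡⟨ count-cong inS-rescale elems ⟨
      count (inS k l u v ∘ (c *_)) elems  ≡⟨ count-reindex _≟_ elems elems-unique elems-complete (c *_) (c ⁻¹ *_)
                                               (x*[x⁻¹*y]≡y c c≢0) (x⁻¹*[x*y]≡y c c≢0) (inS k l u v) ⟩
      count (inS k l u v) elems           ≡⟨ length-filter _ elems ⟨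
      length (SSet F k l u v) ∎

  #S+[0∈S]≡pairCount : ∀ k l u v →
                       length (SSet F k l u v) ℕ.+ iverson (isSymbol u (0# + k) ∧ isSymbol v (0# + l))
                         ≡ pairCount k l u v
  #S+[0∈S]≡pairCount k l u v = begin
    length (SSet F k l u v) ℕ.+ iverson (symbols 0#)
      ≡⟨ cong₂ ℕ._+_ (length-filter _ elems) (sym (count-∧-≟ _≟_ 0# elems elems-unique (elems-complete 0#) symbols)) ⟩
    count (inS k l u v) elems ℕ.+ count (λ a → symbols a ∧ does (0# ≟ a)) elems
      ≡⟨ count-+ _ _ symbols pointwise elems ⟩
    pairCount k l u v ∎
    where
    symbols : Carrier → Bool
    symbols a = isSymbol u (a + k) ∧ isSymbol v (a + l)
    pointwise : ∀ a → iverson (inS k l u v a) ℕ.+ iverson (symbols a ∧ does (0# ≟ a)) ≡ iverson (symbols a)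
    pointwise a with a ≟ 0# | 0# ≟ a
    ... | yes _ | yes _ = cong iverson (∧-identityʳ (symbols a))
    ... | no _ | no _ = trans (cong (λ t → iverson (symbols a) ℕ.+ iverson t) (∧-zeroʳ (symbols a))) (ℕ.+-identityʳ _)
    ... | yes a≡0 | no 0≢a = ⊥-elim (0≢a (sym a≡0))
    ... | no a≢0 | yes 0≡a = ⊥-elim (a≢0 (sym 0≡a))

  β≡[0∈S] : ∀ j l e₁ e₂ →
            betaC F j l e₁ e₂ ≡ ℤ.+ iverson (isSymbol (ε ℤ.* e₁) (0# + - j) ∧ isSymbol e₂ (0# + l))
  β≡[0∈S] j l e₁ e₂ = begin
    betaC F j l e₁ e₂
      ≡⟨ β-by-cases ⟩
    ℤ.+ iverson (does (legendre F j ℤ.≟ e₁) ∧ does (legendre F l ℤ.≟ e₂))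
      ≡⟨ cong (λ b → ℤ.+ iverson b) (cong₂ _∧_ first second) ⟩
    ℤ.+ iverson (isSymbol (ε ℤ.* e₁) (0# + - j) ∧ isSymbol e₂ (0# + l)) ∎
    where
    β-by-cases : betaC F j l e₁ e₂ ≡ ℤ.+ iverson (does ((legendre F j ℤ.≟ e₁) ×-dec (legendre F l ℤ.≟ e₂)))
    β-by-cases with (legendre F j ℤ.≟ e₁) ×-dec (legendre F l ℤ.≟ e₂) in eq
    ... | yes _ = cong (λ d → ℤ.+ iverson (does d)) (sym eq)
    ... | no _ = cong (λ d → ℤ.+ iverson (does d)) (sym eq)
    first : does (legendre F j ℤ.≟ e₁) ≡ isSymbol (ε ℤ.* e₁) (0# + - j)
    first = trans (does-≟-*sign ε-sign (legendre F j) e₁)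
                  (cong (λ s → does (s ℤ.≟ ε ℤ.* e₁))
                        (sym (trans (cong (legendre F) (+-identityˡ (- j))) (legendre-neg j))))
    second : does (legendre F l ℤ.≟ e₂) ≡ isSymbol e₂ (0# + l)
    second = cong (isSymbol e₂) (sym (+-identityˡ l))

  γ≡ : ∀ ν e₁ e₂ → gammaC F ν e₁ e₂ ≡ ℤ.+ iverson (γ-condition ε ν e₁ e₂)
  γ≡ ν e₁ e₂
    with ((ν ℤ.≟ ε ℤ.* e₁) ×-dec (ε ℤ.* e₁ ℤ.≟ e₂)) ⊎-dec ((ℤ.- ε ℤ.≟ ν ℤ.* e₁) ×-dec (ν ℤ.* e₁ ℤ.≟ 1ℤ))
    in eq
  ... | yes _ = cong (λ d → ℤ.+ iverson (does d)) (sym eq)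
  ... | no _ = cong (λ d → ℤ.+ iverson (does d)) (sym eq)

  exponent≡#S : ∀ j l → j + l ≢ 0# → ∀ {e₁ e₂} → Sign e₁ → Sign e₂ →
                mm F ℤ.- betaC F j l e₁ e₂ ℤ.- gammaC F (legendre F (j + l)) e₁ e₂
                  ≡ ℤ.+ length (SSet F (- j) l (ε ℤ.* e₁) e₂)
  exponent≡#S j l j+l≢0 {e₁} {e₂} sign₁ sign₂ = begin
    mm F ℤ.- betaC F j l e₁ e₂ ℤ.- gammaC F ν e₁ e₂
      ≡⟨ cong₂ (λ m x → m ℤ.- x ℤ.- gammaC F ν e₁ e₂) m≡1+pairCount₀ (β≡[0∈S] j l e₁ e₂) ⟩
    ℤ.+ (n₀ ℕ.+ 1) ℤ.- ℤ.+ b ℤ.- gammaC F ν e₁ e₂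
      ≡⟨ cong (λ x → ℤ.+ (n₀ ℕ.+ 1) ℤ.- ℤ.+ b ℤ.- x) (γ≡ ν e₁ e₂) ⟩
    ℤ.+ (n₀ ℕ.+ 1) ℤ.- ℤ.+ b ℤ.- ℤ.+ g            ≡⟨ cong (λ n → ℤ.+ n ℤ.- ℤ.+ b ℤ.- ℤ.+ g) counted ⟨
    ℤ.+ (c ℕ.+ b ℕ.+ g) ℤ.- ℤ.+ b ℤ.- ℤ.+ g       ≡⟨ [c+b+g]-b-g≡c c b g ⟩
    ℤ.+ c ∎
    where
    u ν : ℤ
    u = ε ℤ.* e₁
    ν = legendre F (j + l)
    n₀ c b g : ℕ
    n₀ = pairCount 0# 1# 1ℤ 1ℤ
    c = length (SSet F (- j) l u e₂)
    b = iverson (isSymbol u (0# + - j) ∧ isSymbol e₂ (0# + l))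
    g = iverson (γ-condition ε ν e₁ e₂)
    -j≢l : - j ≢ l
    -j≢l -j≡l = j+l≢0 (trans (cong (j +_) (sym -j≡l)) (-‿inverseʳ j))
    -l-j≡-[j+l] : - l + - j ≡ - (j + l)
    -l-j≡-[j+l] = trans (-‿+-comm l j) (cong -_ (+-comm l j))
    γ-instance : iverson (does (ε ℤ.≟ 1ℤ)) ℕ.+ iverson (does (1ℤ ℤ.≟ ℤ.- (u ℤ.* e₂))) ℕ.+ g ℕ.+ g
                   ≡ 1 ℕ.+ iverson (isSymbol u (- l + - j)) ℕ.+ iverson (isSymbol e₂ (- - j + l))
    γ-instance = trans (γ-table ε-sign (legendre-sign j+l≢0) sign₁ sign₂)
      (cong₂ (λ x y → 1 ℕ.+ iverson x ℕ.+ iverson y)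
             (cong (λ s → does (s ℤ.≟ u)) (sym (trans (cong (legendre F) -l-j≡-[j+l]) (legendre-neg (j + l)))))
             (cong (isSymbol e₂) (cong (_+ l) (sym (-‿involutive j)))))
    counted : c ℕ.+ b ℕ.+ g ≡ n₀ ℕ.+ 1
    counted = exponent-count {c = c} {b = b} (pairCount-diagonal (- j) l -j≢l (Sign-* ε-sign sign₁) sign₂)
                             pairCount₀-diagonal (#S+[0∈S]≡pairCount (- j) l u e₂) γ-instance

  four≡2*2 : four F ≡ (1# + 1#) * (1# + 1#)
  four≡2*2 = trans (+-assoc (1# + 1#) 1# 1#) (x+x≡x*[1+1] (1# + 1#))

  four≢0 : four F ≢ 0#
  four≢0 four≡0 = *-≢0 1+1≢0 1+1≢0 (trans (sym four≡2*2) four≡0)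

  [-x]/y≡-[x/y] : ∀ x y → _/F_ F (- x) y ≡ - _/F_ F x y
  [-x]/y≡-[x/y] x y = sym (-‿distribˡ-* x (y ⁻¹))

  legendre-/four : ∀ x → legendre F (_/F_ F x (four F)) ≡ legendre F x
  legendre-/four x = begin
    legendre F (x * four F ⁻¹)                ≡⟨ legendre-* x (four F ⁻¹) ⟩
    legendre F x ℤ.* legendre F (four F ⁻¹)
      ≡⟨ cong (legendre F x ℤ.*_) (legendre-square (⁻¹-≢0 _ four≢0) half four⁻¹≡half²) ⟩
    legendre F x ℤ.* 1ℤ                       ≡⟨ ℤ.*-identityʳ (legendre F x) ⟩
    legendre F x ∎
    where
    half : Carrier
    half = (1# + 1#) ⁻¹
    four⁻¹≡half² : half * half ≡ four F ⁻¹
    four⁻¹≡half² = ⁻¹-unique (four F) (half * half) (begin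
      four F * (half * half)                    ≡⟨ cong (_* (half * half)) four≡2*2 ⟩
      ((1# + 1#) * (1# + 1#)) * (half * half)   ≡⟨ *-interchange _ _ _ _ ⟩
      ((1# + 1#) * half) * ((1# + 1#) * half)   ≡⟨ cong (λ z → z * z) (*-inverse _ 1+1≢0) ⟩
      1# * 1#                                   ≡⟨ *-identityˡ 1# ⟩
      1# ∎)

  prodS-normalise : ∀ j' l' → j' + l' ≢ 0# → ∀ {e₁ e₂} → Sign e₁ → Sign e₂ →
    let c = _/F_ F (j' + l') (four F)
        ν = legendre F (j' + l')
        ex = mm F ℤ.- betaC F j' l' e₁ e₂ ℤ.- gammaC F ν e₁ e₂
    in prodS F (- j') l' (ε ℤ.* e₁) e₂
         ≡ zpow F c ex * prodS F (- _/F_ F j' c) (_/F_ F l' c) (ν ℤ.* ε ℤ.* e₁) (ν ℤ.* e₂)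
  prodS-normalise j' l' j'+l'≢0 {e₁} {e₂} sign₁ sign₂ = begin
    prodS F (- j') l' (ε ℤ.* e₁) e₂
      ≡⟨ prodS-rescale (*-≢0 j'+l'≢0 (⁻¹-≢0 _ four≢0)) (- j') l' (ε ℤ.* e₁) e₂ ⟩
    pow F c #S * prodS F (_/F_ F (- j') c) l (legendre F c ℤ.* (ε ℤ.* e₁)) (legendre F c ℤ.* e₂)
      ≡⟨ cong (λ s → pow F c #S * prodS F (_/F_ F (- j') c) l (s ℤ.* (ε ℤ.* e₁)) (s ℤ.* e₂))
              (legendre-/four (j' + l')) ⟩
    pow F c #S * prodS F (_/F_ F (- j') c) l (ν ℤ.* (ε ℤ.* e₁)) (ν ℤ.* e₂)
      ≡⟨ cong₂ (λ k u → pow F c #S * prodS F k l u (ν ℤ.* e₂)) ([-x]/y≡-[x/y] j' c) (sym (ℤ.*-assoc ν ε e₁)) ⟩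
    pow F c #S * prodS F (- j) l (ν ℤ.* ε ℤ.* e₁) (ν ℤ.* e₂)
      ≡⟨ cong (λ n → zpow F c n * prodS F (- j) l (ν ℤ.* ε ℤ.* e₁) (ν ℤ.* e₂))
              (exponent≡#S j' l' j'+l'≢0 sign₁ sign₂) ⟨
    zpow F c (mm F ℤ.- betaC F j' l' e₁ e₂ ℤ.- gammaC F ν e₁ e₂) * prodS F (- j) l (ν ℤ.* ε ℤ.* e₁) (ν ℤ.* e₂) ∎
    where
    c j l : Carrier
    c = _/F_ F (j' + l') (four F)
    j = _/F_ F j' c
    l = _/F_ F l' c
    ν : ℤ
    ν = legendre F (j' + l')
    #S : ℕ
    #S = length (SSet F (- j') l' (ε ℤ.* e₁) e₂)

  prodS≡prodT : ∀ j l s u v → prodS F (- j) l (s ℤ.* ε ℤ.* u) v ≡ prodT F j l (s ℤ.* u) v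
  prodS≡prodT j l s u v = begin
    prodS F (- j) l (s ℤ.* ε ℤ.* u) v   ≡⟨ cong (λ w → prodS F (- j) l w v) sεu≡εsu ⟩
    prodS F (- j) l (ε ℤ.* (s ℤ.* u)) v ≡⟨ prodT≡prodS j l (s ℤ.* u) v ⟨
    prodT F j l (s ℤ.* u) v ∎
    where
    sεu≡εsu : s ℤ.* ε ℤ.* u ≡ ε ℤ.* (s ℤ.* u)
    sεu≡εsu = trans (cong (ℤ._* u) (ℤ.*-comm s ε)) (ℤ.*-assoc ε s u)

sign-of : ∀ {e} → e ≡ 1ℤ ⊎ e ≡ -1ℤ → Sign e
sign-of (inj₁ refl) = plus
sign-of (inj₂ refl) = minus

theorem5p1 : (F : FiniteField) → order F % 2 ≡ 1 →
  (j' l' : FiniteField.Carrier F) → FiniteField._+_ F j' l' ≢ FiniteField.0# F →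
  (e1 e2 : ℤ) → (e1 ≡ 1ℤ ⊎ e1 ≡ -1ℤ) → (e2 ≡ 1ℤ ⊎ e2 ≡ -1ℤ) →
  let open FiniteField F
      ε = epsilon F
      lam = _/F_ F (j' + l') (four F)
      ν = legendre F (j' + l')
      j = _/F_ F j' lam
      l = _/F_ F l' lam
      ex = mm F ℤ.- betaC F j' l' e1 e2 ℤ.- gammaC F ν e1 e2
  in (prodT F j' l' e1 e2 ≡ prodS F (- j') l' (ε ℤ.* e1) e2)
     × (prodS F (- j') l' (ε ℤ.* e1) e2
          ≡ zpow F lam ex * prodS F (- j) l (ν ℤ.* ε ℤ.* e1) (ν ℤ.* e2))
     × (zpow F lam ex * prodS F (- j) l (ν ℤ.* ε ℤ.* e1) (ν ℤ.* e2)
          ≡ zpow F lam ex * prodT F j l (ν ℤ.* e1) (ν ℤ.* e2))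
theorem5p1 F odd j' l' j'+l'≢0 e1 e2 e1-sign e2-sign =
    prodT≡prodS j' l' e1 e2
  , prodS-normalise j' l' j'+l'≢0 (sign-of e1-sign) (sign-of e2-sign)
  , cong (zpow F lam ex *_) (prodS≡prodT j l ν e1 (ν ℤ.* e2))
  where
  open FiniteField F
  open OddFiniteField F odd
  lam j l : Carrier
  lam = _/F_ F (j' + l') (four F)
  j = _/F_ F j' lam
  l = _/F_ F l' lam
  ν ex : ℤ
  ν = legendre F (j' + l')
  ex = mm F ℤ.- betaC F j' l' e1 e2 ℤ.- gammaC F ν e1 e2
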